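{- Let $m\ge1$. Define polynomials $H_i(u)\equiv H_i(z;u)$ in $z,u$ by \[ H_{m+1}(u)=u^{m+2}\left(1-z\sum_{e=0}^m u^e(m+1-e)\right), \] and, for $0\le i\le m$, \[ H_i(u)=u^{i+1}\left(1+\sum_{k=1}^{i+1}(-z)^k\binom{i+1}{k}\sum_{e=0}^{m-i}\binom{e+k-1}{e}u^e+\sum_{k=1}^{i}(-z)^k\binom{m+k-i-1}{k-1}\sum_{e=0}^{i-k}\binom{e+k}{e}u^{m+1-k-e}\right). \] Then $H_i=(u+z\nabla_m)H_{i-1}$ for $1\le i\le m+1$, i.e. \[ H_i(u)=uH_{i-1}(u)+zu\,\frac{H_{i-1}(u)-u^{m+1}H_{i-1}(1)}{u-1}. \]
   Context: The operator $\nabla_m$ acts on polynomials in $u$ (with coefficients polynomial in $z$) by $\nabla_m H=u\,\frac{H-u^{m+1}H(1)}{u-1}$, where $H(1)$ is the specialisation at $u=1$. -}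

module Defs where

open import Data.Nat as ℕ using (ℕ; zero; suc; _∸_; _≤?_)
open import Data.Nat.Combinatorics using (_C_)
open import Data.Integer as ℤ using (ℤ; +_; -_)
open import Data.List using (List; []; _∷_; map; foldr; upTo)
open import Relation.Nullary using (yes; no)

-- Dense univariate polynomials over a "raw ring" of coefficients,
-- represented as coefficient lists [a₀, a₁, …] (lowest degree first).

record RawRing (A : Set) : Set where
  field
    0# : A
    1# : A
    _⊕_ : A → A → A
    _⊗_ : A → A → A
    ⊖_  : A → A

module PolyOps {A : Set} (R : RawRing A) where
  open RawRing R

  Poly : Set
  Poly = List A

  infixl 6 _+ₚ_ _-ₚ_
  infixl 7 _*ₚ_

  _+ₚ_ : Poly → Poly → Poly
  [] +ₚ q = q
  (a ∷ p) +ₚ [] = a ∷ p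
  (a ∷ p) +ₚ (b ∷ q) = (a ⊕ b) ∷ (p +ₚ q)

  negₚ : Poly → Poly
  negₚ = map ⊖_

  _-ₚ_ : Poly → Poly → Poly
  p -ₚ q = p +ₚ negₚ q

  scale : A → Poly → Poly
  scale a = map (a ⊗_)

  _*ₚ_ : Poly → Poly → Poly
  [] *ₚ q = []
  (a ∷ p) *ₚ q = scale a q +ₚ (0# ∷ (p *ₚ q))

  const : A → Poly
  const a = a ∷ []

  X^ : ℕ → Poly
  X^ zero = 1# ∷ []
  X^ (suc n) = 0# ∷ X^ n

  at1 : Poly → A
  at1 = foldr _⊕_ 0#

  -- quotient of the division of p by (X - 1) (synthetic division);
  -- the discarded remainder is at1 p, so this is the exact quotient
  -- whenever p(1) = 0.
  sufSums : Poly → Poly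
  sufSums [] = []
  sufSums (a ∷ p) = (a ⊕ at1 p) ∷ sufSums p

  divXm1 : Poly → Poly
  divXm1 [] = []
  divXm1 (_ ∷ p) = sufSums p

  coeff : Poly → ℕ → A
  coeff [] _ = 0#
  coeff (a ∷ p) zero = a
  coeff (a ∷ p) (suc n) = coeff p n

ℤRing : RawRing ℤ
ℤRing = record { 0# = + 0 ; 1# = + 1 ; _⊕_ = ℤ._+_ ; _⊗_ = ℤ._*_ ; ⊖_ = -_ }

module Z = PolyOps ℤRing

ℤ[z] : Set
ℤ[z] = Z.Poly

ℤ[z]Ring : RawRing ℤ[z]
ℤ[z]Ring = record { 0# = [] ; 1# = Z.const (+ 1) ; _⊕_ = Z._+ₚ_ ; _⊗_ = Z._*ₚ_ ; ⊖_ = Z.negₚ }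

module U = PolyOps ℤ[z]Ring

ℤ[z,u] : Set
ℤ[z,u] = U.Poly

open U public using (_+ₚ_; _-ₚ_; _*ₚ_)

coeff₂ : ℤ[z,u] → ℕ → ℕ → ℤ
coeff₂ p a b = Z.coeff (U.coeff p b) a

_≈ₚ_ : ℤ[z,u] → ℤ[z,u] → Set
p ≈ₚ q = ∀ a b → coeff₂ p a b Relation.Binary.PropositionalEquality.≡ coeff₂ q a b
  where import Relation.Binary.PropositionalEquality

infix 4 _≈ₚ_

uP : ℤ[z,u]
uP = U.X^ 1

u^ : ℕ → ℤ[z,u]
u^ = U.X^

zP : ℤ[z,u]
zP = U.const (Z.X^ 1)

cst : ℤ → ℤ[z,u]
cst c = U.const (Z.const c)

nat : ℕ → ℤ[z,u]
nat n = cst (+ n)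

oneP : ℤ[z,u]
oneP = nat 1

mz^ : ℕ → ℤ[z,u]
mz^ zero = oneP
mz^ (suc k) = cst (- (+ 1)) *ₚ zP *ₚ mz^ k

-- Σ_{k=lo}^{hi} f k  (empty if hi < lo)
Σ[_⋯_] : ℕ → ℕ → (ℕ → ℤ[z,u]) → ℤ[z,u]
Σ[ lo ⋯ hi ] f = foldr (λ k acc → f k +ₚ acc) [] (map (lo ℕ.+_) (upTo (suc hi ∸ lo)))

∇ : ℕ → ℤ[z,u] → ℤ[z,u]
∇ m H = uP *ₚ U.divXm1 (H -ₚ (u^ (suc m) *ₚ U.const (U.at1 H)))

Htop : ℕ → ℤ[z,u]
Htop m = u^ (suc (suc m)) *ₚ
  (oneP -ₚ zP *ₚ Σ[ 0 ⋯ m ] (λ e → u^ e *ₚ nat (suc m ∸ e)))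

Hlow : ℕ → ℕ → ℤ[z,u]
Hlow m i = u^ (suc i) *ₚ
  ( oneP
  +ₚ Σ[ 1 ⋯ suc i ] (λ k → mz^ k *ₚ nat (suc i C k) *ₚ
        Σ[ 0 ⋯ m ∸ i ] (λ e → nat ((e ℕ.+ k ∸ 1) C e) *ₚ u^ e))
  +ₚ Σ[ 1 ⋯ i ] (λ k → mz^ k *ₚ nat ((m ℕ.+ k ∸ i ∸ 1) C (k ∸ 1)) *ₚ
        Σ[ 0 ⋯ i ∸ k ] (λ e → nat ((e ℕ.+ k) C e) *ₚ u^ (suc m ∸ k ∸ e))))

-- H_i for 0 ≤ i ≤ m+1 (the value for i > m+1 is irrelevant)
H : ℕ → ℕ → ℤ[z,u]
H m i with i ≤? m
... | yes _ = Hlow m i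
... | no _  = Htop m

module Submission where

-- Compare coefficients of z^a u^b. As H − u^{m+1} H(1) vanishes at u = 1, the coefficient of
-- u^{b+1} in ∇_m H is the tail sum Σ_{n>b} of the coefficients of H − u^{m+1} H(1). So
-- H_i = (u + z∇_m) H_{i−1} says: the z⁰-row of H_i is that of H_{i−1} shifted by u, and
-- gap(a, b) = [z^{a+1} u^{b+1}] H_i − [z^{a+1} u^b] H_{i−1} equals that tail sum for row a.
-- Both sides obey the same first-order recurrence in b, started at b = 0 for b ≤ m and from
-- the vanishing of both for large b beyond m. On the explicit binomial coefficients of H_i
-- (read off from the defining double sums) each recurrence step is Pascal's rule.

open import Defs
open import Data.Nat as ℕ using (ℕ; zero; suc; _∸_; _≤_; _<_; z≤n; s≤s; _<?_; _≤?_)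
import Data.Nat.Properties as ℕP
import Data.Nat.Tactic.RingSolver as ℕ-Solver
open import Data.Nat.Combinatorics using (_C_; nCn≡1; nC1≡n; k>n⇒nCk≡0; nCk≡nC[n∸k]; nCk+nC[k+1]≡[n+1]C[k+1])
open import Data.Integer as ℤ using (ℤ; +_; -_)
import Data.Integer.Properties as ℤP
open import Data.List using ([]; _∷_; map; foldr; applyUpTo; drop; length)
open import Relation.Binary.PropositionalEquality
open import Relation.Nullary using (¬_; Dec; yes; no)
open import Data.Empty using (⊥-elim)
open import Data.Product using (_,_)
open import Data.Sum using (inj₁; inj₂)
open import Data.Integer.Tactic.RingSolver using (solve-∀)
open import Relation.Binary using (tri<; tri≈; tri>)
open import Function using (_∘_)

Z-coeff-+ : ∀ p q n → Z.coeff (p Z.+ₚ q) n ≡ Z.coeff p n ℤ.+ Z.coeff q n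
Z-coeff-+ [] q n = sym (ℤP.+-identityˡ _)
Z-coeff-+ (a ∷ p) [] n = sym (ℤP.+-identityʳ _)
Z-coeff-+ (a ∷ p) (b ∷ q) zero = refl
Z-coeff-+ (a ∷ p) (b ∷ q) (suc n) = Z-coeff-+ p q n

Z-coeff-neg : ∀ q n → Z.coeff (Z.negₚ q) n ≡ - Z.coeff q n
Z-coeff-neg [] n = refl
Z-coeff-neg (x ∷ q) zero = refl
Z-coeff-neg (x ∷ q) (suc n) = Z-coeff-neg q n

Z-coeff-scale : ∀ a q n → Z.coeff (Z.scale a q) n ≡ a ℤ.* Z.coeff q n
Z-coeff-scale a [] n = sym (ℤP.*-zeroʳ a)
Z-coeff-scale a (x ∷ q) zero = refl
Z-coeff-scale a (x ∷ q) (suc n) = Z-coeff-scale a q n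

Z-coeff-*-cons : ∀ a p q n →
  Z.coeff ((a ∷ p) Z.*ₚ q) n ≡ a ℤ.* Z.coeff q n ℤ.+ Z.coeff (+ 0 ∷ p Z.*ₚ q) n
Z-coeff-*-cons a p q n =
  trans (Z-coeff-+ (Z.scale a q) _ n) (cong (ℤ._+ _) (Z-coeff-scale a q n))

Z-coeff-*-[] : ∀ p n → Z.coeff (p Z.*ₚ []) n ≡ + 0
Z-coeff-*-[] [] n = refl
Z-coeff-*-[] (x ∷ p) zero = refl
Z-coeff-*-[] (x ∷ p) (suc n) = Z-coeff-*-[] p n

Z-coeff-*-const : ∀ a q n → Z.coeff ((a ∷ []) Z.*ₚ q) n ≡ a ℤ.* Z.coeff q n
Z-coeff-*-const a q zero = trans (Z-coeff-*-cons a [] q 0) (ℤP.+-identityʳ _)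
Z-coeff-*-const a q (suc n) = trans (Z-coeff-*-cons a [] q (suc n)) (ℤP.+-identityʳ _)

Z-coeff-*-z : ∀ p q n → Z.coeff ((+ 0 ∷ p) Z.*ₚ q) (suc n) ≡ Z.coeff (p Z.*ₚ q) n
Z-coeff-*-z p q n = trans (Z-coeff-*-cons (+ 0) p q (suc n)) (ℤP.+-identityˡ _)

Z-coeff-*-constʳ : ∀ p q → (∀ n → Z.coeff q (suc n) ≡ + 0) →
  ∀ n → Z.coeff (p Z.*ₚ q) n ≡ Z.coeff p n ℤ.* Z.coeff q 0
Z-coeff-*-constʳ [] q q-const n = refl
Z-coeff-*-constʳ (x ∷ p) q q-const zero = trans (Z-coeff-*-cons x p q 0) (ℤP.+-identityʳ _)
Z-coeff-*-constʳ (x ∷ p) q q-const (suc n) = begin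
  Z.coeff ((x ∷ p) Z.*ₚ q) (suc n)                   ≡⟨ Z-coeff-*-cons x p q (suc n) ⟩
  x ℤ.* Z.coeff q (suc n) ℤ.+ Z.coeff (p Z.*ₚ q) n  ≡⟨ cong₂ ℤ._+_ (cong (x ℤ.*_) (q-const n)) (Z-coeff-*-constʳ p q q-const n) ⟩
  x ℤ.* + 0 ℤ.+ Z.coeff p n ℤ.* Z.coeff q 0          ≡⟨ cong (ℤ._+ _) (ℤP.*-zeroʳ x) ⟩
  + 0 ℤ.+ Z.coeff p n ℤ.* Z.coeff q 0                ≡⟨ ℤP.+-identityˡ _ ⟩
  Z.coeff p n ℤ.* Z.coeff q 0                        ∎
  where open ≡-Reasoning

coeff₂-+ₚ : ∀ p q a b → coeff₂ (p +ₚ q) a b ≡ coeff₂ p a b ℤ.+ coeff₂ q a b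
coeff₂-+ₚ [] q a b = sym (ℤP.+-identityˡ _)
coeff₂-+ₚ (x ∷ p) [] a b = sym (ℤP.+-identityʳ _)
coeff₂-+ₚ (x ∷ p) (y ∷ q) a zero = Z-coeff-+ x y a
coeff₂-+ₚ (x ∷ p) (y ∷ q) a (suc b) = coeff₂-+ₚ p q a b

coeff₂-negₚ : ∀ q a b → coeff₂ (U.negₚ q) a b ≡ - coeff₂ q a b
coeff₂-negₚ [] a b = refl
coeff₂-negₚ (x ∷ q) a zero = Z-coeff-neg x a
coeff₂-negₚ (x ∷ q) a (suc b) = coeff₂-negₚ q a b

coeff₂--ₚ : ∀ p q a b → coeff₂ (p -ₚ q) a b ≡ coeff₂ p a b ℤ.- coeff₂ q a b
coeff₂--ₚ p q a b =
  trans (coeff₂-+ₚ p (U.negₚ q) a b) (cong (ℤ._+_ (coeff₂ p a b)) (coeff₂-negₚ q a b))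

coeff₂-scale : ∀ c q a b → coeff₂ (U.scale c q) a b ≡ Z.coeff (c Z.*ₚ U.coeff q b) a
coeff₂-scale c [] a b = sym (Z-coeff-*-[] c a)
coeff₂-scale c (x ∷ q) a zero = refl
coeff₂-scale c (x ∷ q) a (suc b) = coeff₂-scale c q a b

coeff₂-*-cons : ∀ c p q a b →
  coeff₂ ((c ∷ p) *ₚ q) a b ≡ Z.coeff (c Z.*ₚ U.coeff q b) a ℤ.+ coeff₂ ([] ∷ p *ₚ q) a b
coeff₂-*-cons c p q a b =
  trans (coeff₂-+ₚ (U.scale c q) _ a b) (cong (ℤ._+ _) (coeff₂-scale c q a b))

coeff₂-*-const : ∀ c q a b → coeff₂ ((c ∷ []) *ₚ q) a b ≡ Z.coeff (c Z.*ₚ U.coeff q b) a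
coeff₂-*-const c q a zero = trans (coeff₂-*-cons c [] q a 0) (ℤP.+-identityʳ _)
coeff₂-*-const c q a (suc b) = trans (coeff₂-*-cons c [] q a (suc b)) (ℤP.+-identityʳ _)

coeff₂-*-u : ∀ p q a b → coeff₂ (([] ∷ p) *ₚ q) a (suc b) ≡ coeff₂ (p *ₚ q) a b
coeff₂-*-u p q a b = trans (coeff₂-*-cons [] p q a (suc b)) (ℤP.+-identityˡ _)

coeff₂-one* : ∀ p a b → coeff₂ (oneP *ₚ p) a b ≡ coeff₂ p a b
coeff₂-one* p a b = trans (coeff₂-*-const (Z.const (+ 1)) p a b)
  (trans (Z-coeff-*-const (+ 1) (U.coeff p b) a) (ℤP.*-identityˡ _))

coeff₂-u^* : ∀ n p a b → coeff₂ (u^ n *ₚ p) a (n ℕ.+ b) ≡ coeff₂ p a b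
coeff₂-u^* zero p a b = coeff₂-one* p a b
coeff₂-u^* (suc n) p a b = trans (coeff₂-*-u (u^ n) p a (n ℕ.+ b)) (coeff₂-u^* n p a b)

coeff₂-u^*-below : ∀ n p a b → b < n → coeff₂ (u^ n *ₚ p) a b ≡ + 0
coeff₂-u^*-below (suc n) p a zero _ = coeff₂-*-cons [] (u^ n) p a 0
coeff₂-u^*-below (suc n) p a (suc b) (s≤s b<n) =
  trans (coeff₂-*-u (u^ n) p a b) (coeff₂-u^*-below n p a b b<n)

coeff₂-u^*const-off : ∀ n c a b → ¬ (b ≡ n) → coeff₂ (u^ n *ₚ U.const c) a b ≡ + 0
coeff₂-u^*const-off n c a b b≢n with ℕP.<-cmp b n
... | tri< b<n _ _ = coeff₂-u^*-below n (U.const c) a b b<n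
... | tri≈ _ b≡n _ = ⊥-elim (b≢n b≡n)
... | tri> _ _ b>n with ℕP.m≤n⇒∃[o]m+o≡n b>n
...   | o , refl = trans (cong (coeff₂ (u^ n *ₚ U.const c) a) (sym (ℕP.+-suc n o)))
                         (coeff₂-u^* n (U.const c) a (suc o))

coeff₂-zP* : ∀ p a b → coeff₂ (zP *ₚ p) (suc a) b ≡ coeff₂ p a b
coeff₂-zP* p a b = begin
  coeff₂ (zP *ₚ p) (suc a) b                          ≡⟨ coeff₂-*-const (Z.X^ 1) p (suc a) b ⟩
  Z.coeff (Z.X^ 1 Z.*ₚ U.coeff p b) (suc a)           ≡⟨ Z-coeff-*-z (Z.const (+ 1)) (U.coeff p b) a ⟩
  Z.coeff (Z.const (+ 1) Z.*ₚ U.coeff p b) a          ≡⟨ Z-coeff-*-const (+ 1) (U.coeff p b) a ⟩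
  + 1 ℤ.* coeff₂ p a b                                ≡⟨ ℤP.*-identityˡ _ ⟩
  coeff₂ p a b                                        ∎
  where open ≡-Reasoning

coeff₂-zP*-0 : ∀ p b → coeff₂ (zP *ₚ p) 0 b ≡ + 0
coeff₂-zP*-0 p b = trans (coeff₂-*-const (Z.X^ 1) p 0 b) (Z-coeff-*-cons (+ 0) (Z.const (+ 1)) (U.coeff p b) 0)

coeff₂-nat* : ∀ n p a b → coeff₂ (nat n *ₚ p) a b ≡ + n ℤ.* coeff₂ p a b
coeff₂-nat* n p a b =
  trans (coeff₂-*-const (Z.const (+ n)) p a b) (Z-coeff-*-const (+ n) (U.coeff p b) a)

coeff₂-u^-diag : ∀ e → coeff₂ (u^ e) 0 e ≡ + 1
coeff₂-u^-diag zero = refl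
coeff₂-u^-diag (suc e) = coeff₂-u^-diag e

coeff₂-u^-z : ∀ e a b → coeff₂ (u^ e) (suc a) b ≡ + 0
coeff₂-u^-z zero a zero = refl
coeff₂-u^-z zero a (suc b) = refl
coeff₂-u^-z (suc e) a zero = refl
coeff₂-u^-z (suc e) a (suc b) = coeff₂-u^-z e a b

coeff₂-u^-off : ∀ e a b → ¬ (b ≡ e) → coeff₂ (u^ e) a b ≡ + 0
coeff₂-u^-off zero a zero b≢e = ⊥-elim (b≢e refl)
coeff₂-u^-off zero a (suc b) b≢e = refl
coeff₂-u^-off (suc e) a zero b≢e = refl
coeff₂-u^-off (suc e) a (suc b) b≢e = coeff₂-u^-off e a b (b≢e ∘ cong suc)

[-1]^ : ℕ → ℤ
[-1]^ zero = + 1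
[-1]^ (suc k) = - [-1]^ k

-- The ℤ[z]-polynomial (-z)^k, read off as the constant-in-u coefficient of mz^ k.
[-z]^ : ℕ → ℤ[z]
[-z]^ zero = Z.const (+ 1)
[-z]^ (suc k) = U.coeff ((cst (- + 1) *ₚ zP) *ₚ ([-z]^ k ∷ [])) 0

mz^≡const : ∀ k → mz^ k ≡ [-z]^ k ∷ []
mz^≡const zero = refl
mz^≡const (suc k) rewrite mz^≡const k = refl

Z-coeff-[-z]^-suc : ∀ k a → Z.coeff ([-z]^ (suc k)) a ≡ Z.coeff (+ 0 ∷ (- + 1 ∷ []) Z.*ₚ [-z]^ k) a
Z-coeff-[-z]^-suc k a =
  trans (Z-coeff-+ ((+ 0 ∷ - + 1 ∷ []) Z.*ₚ [-z]^ k) [] a)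
        (trans (ℤP.+-identityʳ _)
          (trans (Z-coeff-*-cons (+ 0) (- + 1 ∷ []) ([-z]^ k) a) (ℤP.+-identityˡ _)))

Z-coeff-[-z]^-diag : ∀ k → Z.coeff ([-z]^ k) k ≡ [-1]^ k
Z-coeff-[-z]^-diag zero = refl
Z-coeff-[-z]^-diag (suc k) = begin
  Z.coeff ([-z]^ (suc k)) (suc k)          ≡⟨ Z-coeff-[-z]^-suc k (suc k) ⟩
  Z.coeff ((- + 1 ∷ []) Z.*ₚ [-z]^ k) k    ≡⟨ Z-coeff-*-const (- + 1) ([-z]^ k) k ⟩
  - + 1 ℤ.* Z.coeff ([-z]^ k) k            ≡⟨ ℤP.-1*i≡-i _ ⟩
  - Z.coeff ([-z]^ k) k                    ≡⟨ cong -_ (Z-coeff-[-z]^-diag k) ⟩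
  - [-1]^ k                                ∎
  where open ≡-Reasoning

Z-coeff-[-z]^-off : ∀ k a → ¬ (a ≡ k) → Z.coeff ([-z]^ k) a ≡ + 0
Z-coeff-[-z]^-off zero zero a≢k = ⊥-elim (a≢k refl)
Z-coeff-[-z]^-off zero (suc a) a≢k = refl
Z-coeff-[-z]^-off (suc k) zero a≢k = Z-coeff-[-z]^-suc k 0
Z-coeff-[-z]^-off (suc k) (suc a) a≢k = begin
  Z.coeff ([-z]^ (suc k)) (suc a)          ≡⟨ Z-coeff-[-z]^-suc k (suc a) ⟩
  Z.coeff ((- + 1 ∷ []) Z.*ₚ [-z]^ k) a    ≡⟨ Z-coeff-*-const (- + 1) ([-z]^ k) a ⟩
  - + 1 ℤ.* Z.coeff ([-z]^ k) a            ≡⟨ cong (- + 1 ℤ.*_) (Z-coeff-[-z]^-off k a (a≢k ∘ cong suc)) ⟩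
  + 0                                      ∎
  where open ≡-Reasoning

coeff₂-mz^*nat* : ∀ k c q a b → (∀ a′ → coeff₂ q (suc a′) b ≡ + 0) →
  coeff₂ ((mz^ k *ₚ nat c) *ₚ q) a b ≡ Z.coeff ([-z]^ k) a ℤ.* + c ℤ.* coeff₂ q 0 b
coeff₂-mz^*nat* k c q a b q-const rewrite mz^≡const k = begin
  coeff₂ ((ζc ∷ []) *ₚ q) a b          ≡⟨ coeff₂-*-const ζc q a b ⟩
  Z.coeff (ζc Z.*ₚ U.coeff q b) a      ≡⟨ Z-coeff-*-constʳ ζc (U.coeff q b) q-const a ⟩
  Z.coeff ζc a ℤ.* coeff₂ q 0 b        ≡⟨ cong (ℤ._* coeff₂ q 0 b) ζc-coeff ⟩
  Z.coeff ([-z]^ k) a ℤ.* + c ℤ.* coeff₂ q 0 b ∎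
  where
  open ≡-Reasoning
  ζc : ℤ[z]
  ζc = ([-z]^ k Z.*ₚ (+ c ∷ [])) Z.+ₚ []
  ζc-coeff : Z.coeff ζc a ≡ Z.coeff ([-z]^ k) a ℤ.* + c
  ζc-coeff = trans (Z-coeff-+ ([-z]^ k Z.*ₚ (+ c ∷ [])) [] a)
    (trans (ℤP.+-identityʳ _) (Z-coeff-*-constʳ ([-z]^ k) (+ c ∷ []) (λ _ → refl) a))

when : {P : Set} → Dec P → ℤ → ℤ
when (yes _) x = x
when (no _) x = + 0

when-yes : {P : Set} (d : Dec P) (x : ℤ) → P → when d x ≡ x
when-yes (yes _) x p = refl
when-yes (no ¬p) x p = ⊥-elim (¬p p)

when-no : {P : Set} (d : Dec P) (x : ℤ) → ¬ P → when d x ≡ + 0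
when-no (yes p) x ¬p = ⊥-elim (¬p p)
when-no (no _) x ¬p = refl

when-cong : {P : Set} (d : Dec P) {x y : ℤ} → x ≡ y → when d x ≡ when d y
when-cong d refl = refl

when-redundant : {P : Set} (d : Dec P) (x : ℤ) → (¬ P → x ≡ + 0) → when d x ≡ x
when-redundant (yes _) x h = refl
when-redundant (no ¬p) x h = sym (h ¬p)

when-vanishing : {P : Set} (d : Dec P) (x : ℤ) → (P → x ≡ + 0) → when d x ≡ + 0
when-vanishing (yes p) x h = h p
when-vanishing (no _) x h = refl

sumBelow : (ℕ → ℤ) → ℕ → ℤ
sumBelow g zero = + 0
sumBelow g (suc n) = g 0 ℤ.+ sumBelow (g ∘ suc) n

sumBelow-zero : ∀ g n → (∀ x → x < n → g x ≡ + 0) → sumBelow g n ≡ + 0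
sumBelow-zero g zero h = refl
sumBelow-zero g (suc n) h =
  cong₂ ℤ._+_ (h 0 (s≤s z≤n)) (sumBelow-zero (g ∘ suc) n (λ x x<n → h (suc x) (s≤s x<n)))

sumBelow-single : ∀ g n t → t < n → (∀ x → x < n → ¬ x ≡ t → g x ≡ + 0) → sumBelow g n ≡ g t
sumBelow-single g (suc n) zero _ h = begin
  g 0 ℤ.+ sumBelow (g ∘ suc) n  ≡⟨ cong (ℤ._+_ (g 0)) (sumBelow-zero (g ∘ suc) n (λ x x<n → h (suc x) (s≤s x<n) (λ ()))) ⟩
  g 0 ℤ.+ + 0                   ≡⟨ ℤP.+-identityʳ _ ⟩
  g 0                           ∎
  where open ≡-Reasoning
sumBelow-single g (suc n) (suc t) (s≤s t<n) h = begin
  g 0 ℤ.+ sumBelow (g ∘ suc) n  ≡⟨ cong (ℤ._+ sumBelow (g ∘ suc) n) (h 0 (s≤s z≤n) (λ ())) ⟩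
  + 0 ℤ.+ sumBelow (g ∘ suc) n  ≡⟨ ℤP.+-identityˡ _ ⟩
  sumBelow (g ∘ suc) n          ≡⟨ sumBelow-single (g ∘ suc) n t t<n
                                     (λ x x<n x≢t → h (suc x) (s≤s x<n) (x≢t ∘ ℕP.suc-injective)) ⟩
  g (suc t)                     ∎
  where open ≡-Reasoning

sumBelow-select : ∀ g n t → (∀ x → x < n → ¬ x ≡ t → g x ≡ + 0) → sumBelow g n ≡ when (t <? n) (g t)
sumBelow-select g n t h with t <? n
... | yes t<n = sumBelow-single g n t t<n h
... | no t≮n = sumBelow-zero g n (λ x x<n → h x x<n (λ { refl → t≮n x<n }))

coeff₂-Σ : ∀ lo hi f a b →
  coeff₂ (Σ[ lo ⋯ hi ] f) a b ≡ sumBelow (λ x → coeff₂ (f (lo ℕ.+ x)) a b) (suc hi ∸ lo)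
coeff₂-Σ lo hi f a b = go (λ x → x) (suc hi ∸ lo)
  where
  go : ∀ g n → coeff₂ (foldr (λ k acc → f k +ₚ acc) [] (map (lo ℕ.+_) (applyUpTo g n))) a b
                 ≡ sumBelow (λ x → coeff₂ (f (lo ℕ.+ g x)) a b) n
  go g zero = refl
  go g (suc n) = trans (coeff₂-+ₚ (f (lo ℕ.+ g 0)) _ a b) (cong (ℤ._+_ (coeff₂ (f (lo ℕ.+ g 0)) a b)) (go (g ∘ suc) n))

tailSum : ℤ[z,u] → ℕ → ℕ → ℤ
tailSum g a n = Z.coeff (U.at1 (drop n g)) a

tailSum-step : ∀ g a n → tailSum g a n ≡ coeff₂ g a n ℤ.+ tailSum g a (suc n)
tailSum-step g a n = trans (cong (λ x → Z.coeff x a) (at1-drop g n)) (Z-coeff-+ (U.coeff g n) _ a)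
  where
  at1-drop : ∀ g n → U.at1 (drop n g) ≡ U.coeff g n Z.+ₚ U.at1 (drop (suc n) g)
  at1-drop [] zero = refl
  at1-drop [] (suc n) = refl
  at1-drop (x ∷ g) zero = refl
  at1-drop (x ∷ g) (suc n) = at1-drop g n

tailSum-beyond : ∀ g a n → length g ≤ n → tailSum g a n ≡ + 0
tailSum-beyond [] a zero _ = refl
tailSum-beyond [] a (suc n) _ = refl
tailSum-beyond (x ∷ g) a (suc n) (s≤s len≤n) = tailSum-beyond g a n len≤n

Z-coeff-at1-+ : ∀ p q a → Z.coeff (U.at1 (p +ₚ q)) a ≡ Z.coeff (U.at1 p) a ℤ.+ Z.coeff (U.at1 q) a
Z-coeff-at1-+ [] q a = sym (ℤP.+-identityˡ _)
Z-coeff-at1-+ (x ∷ p) [] a = sym (ℤP.+-identityʳ _)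
Z-coeff-at1-+ (x ∷ p) (y ∷ q) a = begin
  Z.coeff ((x Z.+ₚ y) Z.+ₚ U.at1 (p +ₚ q)) a                       ≡⟨ Z-coeff-+ (x Z.+ₚ y) _ a ⟩
  Z.coeff (x Z.+ₚ y) a ℤ.+ Z.coeff (U.at1 (p +ₚ q)) a              ≡⟨ cong₂ ℤ._+_ (Z-coeff-+ x y a) (Z-coeff-at1-+ p q a) ⟩
  (X ℤ.+ Y) ℤ.+ (P ℤ.+ Q)                                         ≡⟨ interchange X Y P Q ⟩
  (X ℤ.+ P) ℤ.+ (Y ℤ.+ Q)                                         ≡⟨ sym (cong₂ ℤ._+_ (Z-coeff-+ x (U.at1 p) a) (Z-coeff-+ y (U.at1 q) a)) ⟩
  Z.coeff (x Z.+ₚ U.at1 p) a ℤ.+ Z.coeff (y Z.+ₚ U.at1 q) a        ∎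
  where
  open ≡-Reasoning
  X = Z.coeff x a
  Y = Z.coeff y a
  P = Z.coeff (U.at1 p) a
  Q = Z.coeff (U.at1 q) a
  interchange : ∀ x y z w → (x ℤ.+ y) ℤ.+ (z ℤ.+ w) ≡ (x ℤ.+ z) ℤ.+ (y ℤ.+ w)
  interchange = solve-∀

Z-coeff-at1-neg : ∀ p a → Z.coeff (U.at1 (U.negₚ p)) a ≡ - Z.coeff (U.at1 p) a
Z-coeff-at1-neg [] a = refl
Z-coeff-at1-neg (x ∷ p) a = begin
  Z.coeff (Z.negₚ x Z.+ₚ U.at1 (U.negₚ p)) a                ≡⟨ Z-coeff-+ (Z.negₚ x) _ a ⟩
  Z.coeff (Z.negₚ x) a ℤ.+ Z.coeff (U.at1 (U.negₚ p)) a     ≡⟨ cong₂ ℤ._+_ (Z-coeff-neg x a) (Z-coeff-at1-neg p a) ⟩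
  - Z.coeff x a ℤ.+ - Z.coeff (U.at1 p) a                   ≡⟨ ℤP.neg-distrib-+ (Z.coeff x a) _ ⟨
  - (Z.coeff x a ℤ.+ Z.coeff (U.at1 p) a)                   ≡⟨ cong -_ (Z-coeff-+ x (U.at1 p) a) ⟨
  - Z.coeff (x Z.+ₚ U.at1 p) a                              ∎
  where open ≡-Reasoning

Z-coeff-at1-u^*const : ∀ n c a → Z.coeff (U.at1 (u^ n *ₚ U.const c)) a ≡ Z.coeff c a
Z-coeff-at1-u^*const zero c a = begin
  Z.coeff ((((+ 1 ∷ []) Z.*ₚ c) Z.+ₚ []) Z.+ₚ []) a  ≡⟨ Z-coeff-+ (((+ 1 ∷ []) Z.*ₚ c) Z.+ₚ []) [] a ⟩
  Z.coeff (((+ 1 ∷ []) Z.*ₚ c) Z.+ₚ []) a ℤ.+ + 0    ≡⟨ ℤP.+-identityʳ _ ⟩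
  Z.coeff (((+ 1 ∷ []) Z.*ₚ c) Z.+ₚ []) a            ≡⟨ Z-coeff-+ ((+ 1 ∷ []) Z.*ₚ c) [] a ⟩
  Z.coeff ((+ 1 ∷ []) Z.*ₚ c) a ℤ.+ + 0              ≡⟨ ℤP.+-identityʳ _ ⟩
  Z.coeff ((+ 1 ∷ []) Z.*ₚ c) a                      ≡⟨ Z-coeff-*-const (+ 1) c a ⟩
  + 1 ℤ.* Z.coeff c a                                ≡⟨ ℤP.*-identityˡ _ ⟩
  Z.coeff c a                                        ∎
  where open ≡-Reasoning
Z-coeff-at1-u^*const (suc n) c a = Z-coeff-at1-u^*const n c a

-- ∇ m P = u · divXm1 (reduce m P); reduce m P vanishes at u = 1.
reduce : ℕ → ℤ[z,u] → ℤ[z,u]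
reduce m P = P -ₚ (u^ (suc m) *ₚ U.const (U.at1 P))

tailSum-reduce-0 : ∀ m P a → tailSum (reduce m P) a 0 ≡ + 0
tailSum-reduce-0 m P a = begin
  Z.coeff (U.at1 (P -ₚ R)) a                              ≡⟨ Z-coeff-at1-+ P (U.negₚ R) a ⟩
  Z.coeff (U.at1 P) a ℤ.+ Z.coeff (U.at1 (U.negₚ R)) a     ≡⟨ cong (ℤ._+_ (Z.coeff (U.at1 P) a)) (Z-coeff-at1-neg R a) ⟩
  Z.coeff (U.at1 P) a ℤ.- Z.coeff (U.at1 R) a              ≡⟨ cong (ℤ._-_ (Z.coeff (U.at1 P) a)) (Z-coeff-at1-u^*const (suc m) (U.at1 P) a) ⟩
  Z.coeff (U.at1 P) a ℤ.- Z.coeff (U.at1 P) a              ≡⟨ ℤP.+-inverseʳ (Z.coeff (U.at1 P) a) ⟩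
  + 0                                                      ∎
  where
  open ≡-Reasoning
  R = u^ (suc m) *ₚ U.const (U.at1 P)

coeff₂-reduce : ∀ m P a b → ¬ (b ≡ suc m) → coeff₂ (reduce m P) a b ≡ coeff₂ P a b
coeff₂-reduce m P a b b≢m+1 = begin
  coeff₂ (reduce m P) a b                                       ≡⟨ coeff₂--ₚ P _ a b ⟩
  coeff₂ P a b ℤ.- coeff₂ (u^ (suc m) *ₚ U.const (U.at1 P)) a b  ≡⟨ cong (λ x → coeff₂ P a b ℤ.- x) (coeff₂-u^*const-off (suc m) (U.at1 P) a b b≢m+1) ⟩
  coeff₂ P a b ℤ.+ + 0                                          ≡⟨ ℤP.+-identityʳ _ ⟩
  coeff₂ P a b                                                  ∎
  where open ≡-Reasoning

coeff₂-∇ : ∀ m P a b → coeff₂ (∇ m P) a (suc b) ≡ tailSum (reduce m P) a (suc b)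
coeff₂-∇ m P a b = trans (coeff₂-u^* 1 (U.divXm1 (reduce m P)) a b)
                         (cong (λ x → Z.coeff x a) (coeff-divXm1 (reduce m P) b))
  where
  coeff-sufSums : ∀ g b → U.coeff (U.sufSums g) b ≡ U.at1 (drop b g)
  coeff-sufSums [] zero = refl
  coeff-sufSums [] (suc b) = refl
  coeff-sufSums (x ∷ g) zero = refl
  coeff-sufSums (x ∷ g) (suc b) = coeff-sufSums g b
  coeff-divXm1 : ∀ g b → U.coeff (U.divXm1 g) b ≡ U.at1 (drop (suc b) g)
  coeff-divXm1 [] zero = refl
  coeff-divXm1 [] (suc b) = refl
  coeff-divXm1 (x ∷ g) b = coeff-sufSums g b

coeff₂-∇-0 : ∀ m P a → coeff₂ (∇ m P) a 0 ≡ + 0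
coeff₂-∇-0 m P a = coeff₂-u^*-below 1 (U.divXm1 (reduce m P)) a 0 (s≤s z≤n)

-- A coefficientwise criterion for Q = (u + z∇_m) P

UZ∇Step : ℕ → ℤ[z,u] → ℤ[z,u] → Set
UZ∇Step m P Q = Q ≈ₚ (uP *ₚ P) +ₚ (zP *ₚ ∇ m P)

gap : ℤ[z,u] → ℤ[z,u] → ℕ → ℕ → ℤ
gap P Q a b = coeff₂ Q (suc a) (suc b) ℤ.- coeff₂ P (suc a) b

record IsUZ∇Step (m : ℕ) (P Q : ℤ[z,u]) : Set where
  field
    z⁰u⁰-zero  : coeff₂ Q 0 0 ≡ + 0
    z⁰-shift   : ∀ b → coeff₂ Q 0 (suc b) ≡ coeff₂ P 0 b
    Q-u⁰-zero  : ∀ a → coeff₂ Q (suc a) 0 ≡ + 0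
    P-u⁰-zero  : ∀ a → coeff₂ P a 0 ≡ + 0
    gap-zero   : ∀ a → gap P Q a 0 ≡ + 0
    gap-up     : ∀ a b → b < m → gap P Q a (suc b) ≡ gap P Q a b ℤ.- coeff₂ P a (suc b)
    gap-down   : ∀ a w → gap P Q a (suc (w ℕ.+ m))
                           ≡ coeff₂ P a (suc (suc (w ℕ.+ m))) ℤ.+ gap P Q a (suc (suc (w ℕ.+ m)))
    gap-bound  : ℕ
    gap-beyond : ∀ a w → gap-bound ≤ w → gap P Q a (suc (w ℕ.+ m)) ≡ + 0

module _ {m : ℕ} {P Q : ℤ[z,u]} (step : IsUZ∇Step m P Q) where
  open IsUZ∇Step step

  private
    g : ℤ[z,u]
    g = reduce m P

    tailSum-down : ∀ a n → ¬ (n ≡ suc m) → tailSum g a (suc n) ≡ tailSum g a n ℤ.- coeff₂ P a n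
    tailSum-down a n n≢m+1 = begin
      tailSum g a (suc n)                                  ≡⟨ rearrange (tailSum g a (suc n)) (coeff₂ P a n) ⟩
      (coeff₂ P a n ℤ.+ tailSum g a (suc n)) ℤ.- coeff₂ P a n  ≡⟨ cong (λ x → (x ℤ.+ tailSum g a (suc n)) ℤ.- coeff₂ P a n) (coeff₂-reduce m P a n n≢m+1) ⟨
      (coeff₂ g a n ℤ.+ tailSum g a (suc n)) ℤ.- coeff₂ P a n  ≡⟨ cong (ℤ._- coeff₂ P a n) (tailSum-step g a n) ⟨
      tailSum g a n ℤ.- coeff₂ P a n                       ∎
      where
      open ≡-Reasoning
      rearrange : ∀ x y → x ≡ (y ℤ.+ x) ℤ.- y
      rearrange = solve-∀

    gap≡tailSum-up : ∀ a b → b ≤ m → gap P Q a b ≡ tailSum g a (suc b)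
    gap≡tailSum-up a zero _ = begin
      gap P Q a 0                       ≡⟨ gap-zero a ⟩
      + 0 ℤ.- + 0                       ≡⟨ cong₂ ℤ._-_ (tailSum-reduce-0 m P a) (P-u⁰-zero a) ⟨
      tailSum g a 0 ℤ.- coeff₂ P a 0    ≡⟨ tailSum-down a 0 (λ ()) ⟨
      tailSum g a 1                     ∎
      where open ≡-Reasoning
    gap≡tailSum-up a (suc b) b<m = begin
      gap P Q a (suc b)                                ≡⟨ gap-up a b b<m ⟩
      gap P Q a b ℤ.- coeff₂ P a (suc b)               ≡⟨ cong (ℤ._- coeff₂ P a (suc b)) (gap≡tailSum-up a b (ℕP.<⇒≤ b<m)) ⟩
      tailSum g a (suc b) ℤ.- coeff₂ P a (suc b)       ≡⟨ tailSum-down a (suc b) (λ b≡m → ℕP.<-irrefl (ℕP.suc-injective b≡m) b<m) ⟨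
      tailSum g a (suc (suc b))                        ∎
      where open ≡-Reasoning

    -- downward induction on the distance t from w to the point where both sides vanish
    gap≡tailSum-down : ∀ a t w → gap-bound ℕ.+ length g ≤ t ℕ.+ w →
      gap P Q a (suc (w ℕ.+ m)) ≡ tailSum g a (suc (suc (w ℕ.+ m)))
    gap≡tailSum-down a zero w bound≤w = begin
      gap P Q a (suc (w ℕ.+ m))           ≡⟨ gap-beyond a w (ℕP.≤-trans (ℕP.m≤m+n gap-bound (length g)) bound≤w) ⟩
      + 0                                 ≡⟨ tailSum-beyond g a (suc (suc (w ℕ.+ m))) length≤ ⟨
      tailSum g a (suc (suc (w ℕ.+ m)))   ∎
      where
      open ≡-Reasoning
      length≤ : length g ≤ suc (suc (w ℕ.+ m))
      length≤ = ℕP.≤-trans (ℕP.m≤n+m (length g) gap-bound)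
                  (ℕP.≤-trans bound≤w (ℕP.m≤n⇒m≤1+n (ℕP.m≤n⇒m≤1+n (ℕP.m≤m+n w m))))
    gap≡tailSum-down a (suc t) w bound≤t+w = begin
      gap P Q a (suc (w ℕ.+ m))
        ≡⟨ gap-down a w ⟩
      coeff₂ P a (suc (suc (w ℕ.+ m))) ℤ.+ gap P Q a (suc (suc (w ℕ.+ m)))
        ≡⟨ cong (ℤ._+_ (coeff₂ P a (suc (suc (w ℕ.+ m)))))
                (gap≡tailSum-down a t (suc w) (ℕP.≤-trans bound≤t+w (ℕP.≤-reflexive (sym (ℕP.+-suc t w))))) ⟩
      coeff₂ P a (suc (suc (w ℕ.+ m))) ℤ.+ tailSum g a (suc (suc (suc (w ℕ.+ m))))
        ≡⟨ cong (ℤ._+ tailSum g a (suc (suc (suc (w ℕ.+ m)))))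
                (coeff₂-reduce m P a (suc (suc (w ℕ.+ m))) (λ eq → ℕP.m≢1+n+m m (sym (ℕP.suc-injective eq)))) ⟨
      coeff₂ g a (suc (suc (w ℕ.+ m))) ℤ.+ tailSum g a (suc (suc (suc (w ℕ.+ m))))
        ≡⟨ tailSum-step g a (suc (suc (w ℕ.+ m))) ⟨
      tailSum g a (suc (suc (w ℕ.+ m)))
        ∎
      where open ≡-Reasoning

    gap≡tailSum : ∀ a b → gap P Q a b ≡ tailSum g a (suc b)
    gap≡tailSum a b with b ≤? m
    ... | yes b≤m = gap≡tailSum-up a b b≤m
    ... | no b≰m with ℕP.m≤n⇒∃[o]m+o≡n (ℕP.≰⇒> b≰m)
    ...   | w , refl = subst (λ n → gap P Q a n ≡ tailSum g a (suc n)) (cong suc (ℕP.+-comm w m))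
                             (gap≡tailSum-down a (gap-bound ℕ.+ length g) w (ℕP.m≤m+n _ w))

    coeff-identity : ∀ a b → coeff₂ (uP *ₚ P) a b ℤ.+ coeff₂ (zP *ₚ ∇ m P) a b ≡ coeff₂ Q a b
    coeff-identity zero zero =
      trans (cong₂ ℤ._+_ (coeff₂-u^*-below 1 P 0 0 (s≤s z≤n)) (coeff₂-zP*-0 (∇ m P) 0)) (sym z⁰u⁰-zero)
    coeff-identity zero (suc b) = begin
      coeff₂ (uP *ₚ P) 0 (suc b) ℤ.+ coeff₂ (zP *ₚ ∇ m P) 0 (suc b)  ≡⟨ cong₂ ℤ._+_ (coeff₂-u^* 1 P 0 b) (coeff₂-zP*-0 (∇ m P) (suc b)) ⟩
      coeff₂ P 0 b ℤ.+ + 0                                          ≡⟨ ℤP.+-identityʳ _ ⟩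
      coeff₂ P 0 b                                                  ≡⟨ z⁰-shift b ⟨
      coeff₂ Q 0 (suc b)                                            ∎
      where open ≡-Reasoning
    coeff-identity (suc a) zero = begin
      coeff₂ (uP *ₚ P) (suc a) 0 ℤ.+ coeff₂ (zP *ₚ ∇ m P) (suc a) 0  ≡⟨ cong₂ ℤ._+_ (coeff₂-u^*-below 1 P (suc a) 0 (s≤s z≤n))
                                                                        (trans (coeff₂-zP* (∇ m P) a 0) (coeff₂-∇-0 m P a)) ⟩
      + 0                                                           ≡⟨ Q-u⁰-zero a ⟨
      coeff₂ Q (suc a) 0                                            ∎
      where open ≡-Reasoning
    coeff-identity (suc a) (suc b) = begin
      coeff₂ (uP *ₚ P) (suc a) (suc b) ℤ.+ coeff₂ (zP *ₚ ∇ m P) (suc a) (suc b)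
        ≡⟨ cong₂ ℤ._+_ (coeff₂-u^* 1 P (suc a) b) (trans (coeff₂-zP* (∇ m P) a (suc b)) (coeff₂-∇ m P a b)) ⟩
      coeff₂ P (suc a) b ℤ.+ tailSum g a (suc b)
        ≡⟨ cong (ℤ._+_ (coeff₂ P (suc a) b)) (gap≡tailSum a b) ⟨
      coeff₂ P (suc a) b ℤ.+ (coeff₂ Q (suc a) (suc b) ℤ.- coeff₂ P (suc a) b)
        ≡⟨ cancel (coeff₂ Q (suc a) (suc b)) (coeff₂ P (suc a) b) ⟩
      coeff₂ Q (suc a) (suc b)
        ∎
      where
      open ≡-Reasoning
      cancel : ∀ x y → y ℤ.+ (x ℤ.- y) ≡ x
      cancel = solve-∀

  IsUZ∇Step⇒≈ : UZ∇Step m P Q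
  IsUZ∇Step⇒≈ a b = sym (trans (coeff₂-+ₚ (uP *ₚ P) (zP *ₚ ∇ m P) a b) (coeff-identity a b))

-- Coefficients of H_i for i ≤ m

coeff₂-Σnat*u^-z : ∀ n (c p : ℕ → ℕ) a d →
  coeff₂ (Σ[ 0 ⋯ n ] (λ e → nat (c e) *ₚ u^ (p e))) (suc a) d ≡ + 0
coeff₂-Σnat*u^-z n c p a d =
  trans (coeff₂-Σ 0 n (λ e → nat (c e) *ₚ u^ (p e)) (suc a) d)
        (sumBelow-zero _ (suc n) (λ e _ →
           trans (coeff₂-nat* (c e) (u^ (p e)) (suc a) d)
                 (trans (cong (+ c e ℤ.*_) (coeff₂-u^-z (p e) a d)) (ℤP.*-zeroʳ (+ c e)))))

coeff₂-Σnat*u^ : ∀ n (c p : ℕ → ℕ) d t → (∀ e → e < suc n → ¬ e ≡ t → ¬ d ≡ p e) →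
  coeff₂ (Σ[ 0 ⋯ n ] (λ e → nat (c e) *ₚ u^ (p e))) 0 d ≡ when (t <? suc n) (+ c t ℤ.* coeff₂ (u^ (p t)) 0 d)
coeff₂-Σnat*u^ n c p d t unique =
  trans (coeff₂-Σ 0 n (λ e → nat (c e) *ₚ u^ (p e)) 0 d)
        (trans (sumBelow-select _ (suc n) t (λ e e≤n e≢t →
                  trans (coeff₂-nat* (c e) (u^ (p e)) 0 d)
                        (trans (cong (+ c e ℤ.*_) (coeff₂-u^-off (p e) 0 d (unique e e≤n e≢t))) (ℤP.*-zeroʳ (+ c e)))))
               (when-cong (t <? suc n) (coeff₂-nat* (c t) (u^ (p t)) 0 d)))

coeff₂-Σmz^-z⁰ : ∀ n (c : ℕ → ℕ) (q : ℕ → ℤ[z,u]) b → (∀ k a → coeff₂ (q k) (suc a) b ≡ + 0) →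
  coeff₂ (Σ[ 1 ⋯ n ] (λ k → mz^ k *ₚ nat (c k) *ₚ q k)) 0 b ≡ + 0
coeff₂-Σmz^-z⁰ n c q b q-const =
  trans (coeff₂-Σ 1 n (λ k → mz^ k *ₚ nat (c k) *ₚ q k) 0 b)
        (sumBelow-zero _ n (λ x _ →
           trans (coeff₂-mz^*nat* (suc x) (c (suc x)) (q (suc x)) 0 b (q-const (suc x)))
                 (cong (λ v → v ℤ.* + c (suc x) ℤ.* coeff₂ (q (suc x)) 0 b) (Z-coeff-[-z]^-off (suc x) 0 (λ ())))))

coeff₂-Σmz^ : ∀ n (c : ℕ → ℕ) (q : ℕ → ℤ[z,u]) κ b → (∀ k a → coeff₂ (q k) (suc a) b ≡ + 0) →
  coeff₂ (Σ[ 1 ⋯ n ] (λ k → mz^ k *ₚ nat (c k) *ₚ q k)) (suc κ) b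
    ≡ when (κ <? n) ([-1]^ (suc κ) ℤ.* + c (suc κ) ℤ.* coeff₂ (q (suc κ)) 0 b)
coeff₂-Σmz^ n c q κ b q-const =
  trans (coeff₂-Σ 1 n (λ k → mz^ k *ₚ nat (c k) *ₚ q k) (suc κ) b)
        (trans (sumBelow-select _ n κ (λ x _ x≢κ →
                  trans (term x)
                        (cong (λ v → v ℤ.* + c (suc x) ℤ.* coeff₂ (q (suc x)) 0 b)
                              (Z-coeff-[-z]^-off (suc x) (suc κ) (x≢κ ∘ sym ∘ ℕP.suc-injective)))))
               (when-cong (κ <? n) (trans (term κ)
                  (cong (λ v → v ℤ.* + c (suc κ) ℤ.* coeff₂ (q (suc κ)) 0 b) (Z-coeff-[-z]^-diag (suc κ))))))
  where
  term : ∀ x → coeff₂ (mz^ (suc x) *ₚ nat (c (suc x)) *ₚ q (suc x)) (suc κ) b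
                 ≡ Z.coeff ([-z]^ (suc x)) (suc κ) ℤ.* + c (suc x) ℤ.* coeff₂ (q (suc x)) 0 b
  term x = coeff₂-mz^*nat* (suc x) (c (suc x)) (q (suc x)) (suc κ) b (q-const (suc x))

-- Hlow m i is definitionally u^{i+1} (1 + outer₁ m i + outer₂ m i), the two double sums of its definition.
inner₁ : ℕ → ℕ → ℕ → ℤ[z,u]
inner₁ m i k = Σ[ 0 ⋯ m ∸ i ] (λ e → nat ((e ℕ.+ k ∸ 1) C e) *ₚ u^ e)

inner₂ : ℕ → ℕ → ℕ → ℤ[z,u]
inner₂ m i k = Σ[ 0 ⋯ i ∸ k ] (λ e → nat ((e ℕ.+ k) C e) *ₚ u^ (suc m ∸ k ∸ e))

outer₁ : ℕ → ℕ → ℤ[z,u]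
outer₁ m i = Σ[ 1 ⋯ suc i ] (λ k → mz^ k *ₚ nat (suc i C k) *ₚ inner₁ m i k)

outer₂ : ℕ → ℕ → ℤ[z,u]
outer₂ m i = Σ[ 1 ⋯ i ] (λ k → mz^ k *ₚ nat ((m ℕ.+ k ∸ i ∸ 1) C (k ∸ 1)) *ₚ inner₂ m i k)

coeff₂-outer₁-z⁰ : ∀ m i d → coeff₂ (outer₁ m i) 0 d ≡ + 0
coeff₂-outer₁-z⁰ m i d = coeff₂-Σmz^-z⁰ (suc i) (suc i C_) (inner₁ m i) d
  (λ k a → coeff₂-Σnat*u^-z (m ∸ i) (λ e → (e ℕ.+ k ∸ 1) C e) (λ e → e) a d)

coeff₂-outer₂-z⁰ : ∀ m i d → coeff₂ (outer₂ m i) 0 d ≡ + 0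
coeff₂-outer₂-z⁰ m i d = coeff₂-Σmz^-z⁰ i (λ k → (m ℕ.+ k ∸ i ∸ 1) C (k ∸ 1)) (inner₂ m i) d
  (λ k a → coeff₂-Σnat*u^-z (i ∸ k) (λ e → (e ℕ.+ k) C e) (λ e → suc m ∸ k ∸ e) a d)

coeff₂-outer₁ : ∀ m i κ d → coeff₂ (outer₁ m i) (suc κ) d
  ≡ when (κ <? suc i) ([-1]^ (suc κ) ℤ.* + (suc i C suc κ) ℤ.* coeff₂ (inner₁ m i (suc κ)) 0 d)
coeff₂-outer₁ m i κ d = coeff₂-Σmz^ (suc i) (suc i C_) (inner₁ m i) κ d
  (λ k a → coeff₂-Σnat*u^-z (m ∸ i) (λ e → (e ℕ.+ k ∸ 1) C e) (λ e → e) a d)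

coeff₂-outer₂ : ∀ m i κ d → coeff₂ (outer₂ m i) (suc κ) d
  ≡ when (κ <? i) ([-1]^ (suc κ) ℤ.* + ((m ℕ.+ suc κ ∸ i ∸ 1) C κ) ℤ.* coeff₂ (inner₂ m i (suc κ)) 0 d)
coeff₂-outer₂ m i κ d = coeff₂-Σmz^ i (λ k → (m ℕ.+ k ∸ i ∸ 1) C (k ∸ 1)) (inner₂ m i) κ d
  (λ k a → coeff₂-Σnat*u^-z (i ∸ k) (λ e → (e ℕ.+ k) C e) (λ e → suc m ∸ k ∸ e) a d)

coeff₂-Hlow : ∀ m i a d → coeff₂ (Hlow m i) a (suc i ℕ.+ d)
  ≡ (coeff₂ oneP a d ℤ.+ coeff₂ (outer₁ m i) a d) ℤ.+ coeff₂ (outer₂ m i) a d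
coeff₂-Hlow m i a d = begin
  coeff₂ (Hlow m i) a (suc i ℕ.+ d)                                      ≡⟨ coeff₂-u^* (suc i) (oneP +ₚ outer₁ m i +ₚ outer₂ m i) a d ⟩
  coeff₂ (oneP +ₚ outer₁ m i +ₚ outer₂ m i) a d                          ≡⟨ coeff₂-+ₚ (oneP +ₚ outer₁ m i) (outer₂ m i) a d ⟩
  coeff₂ (oneP +ₚ outer₁ m i) a d ℤ.+ coeff₂ (outer₂ m i) a d            ≡⟨ cong (ℤ._+ coeff₂ (outer₂ m i) a d) (coeff₂-+ₚ oneP (outer₁ m i) a d) ⟩
  (coeff₂ oneP a d ℤ.+ coeff₂ (outer₁ m i) a d) ℤ.+ coeff₂ (outer₂ m i) a d ∎
  where open ≡-Reasoning

coeff₂-Hlow-below : ∀ m i a b → b < suc i → coeff₂ (Hlow m i) a b ≡ + 0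
coeff₂-Hlow-below m i = coeff₂-u^*-below (suc i) (oneP +ₚ outer₁ m i +ₚ outer₂ m i)

coeff₂-Hlow-z⁰-diag : ∀ m i → coeff₂ (Hlow m i) 0 (suc i) ≡ + 1
coeff₂-Hlow-z⁰-diag m i = begin
  coeff₂ (Hlow m i) 0 (suc i)         ≡⟨ cong (coeff₂ (Hlow m i) 0 ∘ suc) (ℕP.+-identityʳ i) ⟨
  coeff₂ (Hlow m i) 0 (suc i ℕ.+ 0)   ≡⟨ coeff₂-Hlow m i 0 0 ⟩
  (+ 1 ℤ.+ coeff₂ (outer₁ m i) 0 0) ℤ.+ coeff₂ (outer₂ m i) 0 0
      ≡⟨ cong₂ (λ x y → (+ 1 ℤ.+ x) ℤ.+ y) (coeff₂-outer₁-z⁰ m i 0) (coeff₂-outer₂-z⁰ m i 0) ⟩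
  + 1                                 ∎
  where open ≡-Reasoning

coeff₂-Hlow-z⁰-off : ∀ m i b → ¬ (b ≡ suc i) → coeff₂ (Hlow m i) 0 b ≡ + 0
coeff₂-Hlow-z⁰-off m i b b≢i+1 with b <? suc i
... | yes b≤i = coeff₂-Hlow-below m i 0 b b≤i
... | no b≰i with ℕP.m≤n⇒∃[o]m+o≡n (ℕP.≮⇒≥ b≰i)
...   | zero , i+1+0≡b = ⊥-elim (b≢i+1 (trans (sym i+1+0≡b) (ℕP.+-identityʳ _)))
...   | suc d , refl = trans (coeff₂-Hlow m i 0 (suc d))
          (cong₂ (λ x y → (+ 0 ℤ.+ x) ℤ.+ y) (coeff₂-outer₁-z⁰ m i (suc d)) (coeff₂-outer₂-z⁰ m i (suc d)))

[m+n]Cm≡[m+n]Cn : ∀ m n → (m ℕ.+ n) C m ≡ (m ℕ.+ n) C n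
[m+n]Cm≡[m+n]Cn m n = trans (nCk≡nC[n∸k] (ℕP.m≤m+n m n)) (cong ((m ℕ.+ n) C_) (ℕP.m+n∸m≡n m n))

coeff₂-oneP-z : ∀ κ d → coeff₂ oneP (suc κ) d ≡ + 0
coeff₂-oneP-z κ zero = refl
coeff₂-oneP-z κ (suc d) = refl

coeff₂-inner₁ : ∀ m i k d → d ≤ m ∸ i → coeff₂ (inner₁ m i (suc k)) 0 d ≡ + ((d ℕ.+ k) C k)
coeff₂-inner₁ m i k d d≤m∸i = begin
  coeff₂ (inner₁ m i (suc k)) 0 d
    ≡⟨ coeff₂-Σnat*u^ (m ∸ i) (λ e → (e ℕ.+ suc k ∸ 1) C e) (λ e → e) d d (λ e _ e≢d d≡e → e≢d (sym d≡e)) ⟩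
  when (d <? suc (m ∸ i)) (+ ((d ℕ.+ suc k ∸ 1) C d) ℤ.* coeff₂ (u^ d) 0 d)
    ≡⟨ when-yes (d <? suc (m ∸ i)) _ (s≤s d≤m∸i) ⟩
  + ((d ℕ.+ suc k ∸ 1) C d) ℤ.* coeff₂ (u^ d) 0 d
    ≡⟨ trans (cong (+ ((d ℕ.+ suc k ∸ 1) C d) ℤ.*_) (coeff₂-u^-diag d)) (ℤP.*-identityʳ _) ⟩
  + ((d ℕ.+ suc k ∸ 1) C d)
    ≡⟨ cong (λ n → + ((n ∸ 1) C d)) (ℕP.+-suc d k) ⟩
  + ((d ℕ.+ k) C d)
    ≡⟨ cong +_ ([m+n]Cm≡[m+n]Cn d k) ⟩
  + ((d ℕ.+ k) C k)
    ∎
  where open ≡-Reasoning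

-- Parametrisation used below: i = κ + 1 + p, m = i + q, k = κ + 1.
inner₂-exponent : ∀ κ p q e → e ≤ p → suc (suc κ ℕ.+ p ℕ.+ q) ∸ suc κ ∸ e ≡ suc (p ∸ e ℕ.+ q)
inner₂-exponent κ p q e e≤p = begin
  suc κ ℕ.+ p ℕ.+ q ∸ κ ∸ e     ≡⟨ cong (λ n → n ∸ κ ∸ e) (rearrange κ p q) ⟩
  κ ℕ.+ (suc p ℕ.+ q) ∸ κ ∸ e   ≡⟨ cong (_∸ e) (ℕP.m+n∸m≡n κ (suc p ℕ.+ q)) ⟩
  suc p ℕ.+ q ∸ e               ≡⟨ ℕP.+-∸-comm q (ℕP.m≤n⇒m≤1+n e≤p) ⟩
  suc p ∸ e ℕ.+ q               ≡⟨ cong (ℕ._+ q) (ℕP.+-∸-assoc 1 e≤p) ⟩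
  suc (p ∸ e ℕ.+ q)             ∎
  where
  open ≡-Reasoning
  rearrange : ∀ κ p q → suc κ ℕ.+ p ℕ.+ q ≡ κ ℕ.+ (suc p ℕ.+ q)
  rearrange = ℕ-Solver.solve-∀

inner₂-length : ∀ κ p → suc κ ℕ.+ p ∸ suc κ ≡ p
inner₂-length κ p = ℕP.m+n∸m≡n κ p

coeff₂-inner₂-absent : ∀ κ p q d → (∀ e → e ≤ p → ¬ d ≡ suc (p ∸ e ℕ.+ q)) →
  coeff₂ (inner₂ (suc κ ℕ.+ p ℕ.+ q) (suc κ ℕ.+ p) (suc κ)) 0 d ≡ + 0
coeff₂-inner₂-absent κ p q d absent =
  trans (coeff₂-Σnat*u^ (suc κ ℕ.+ p ∸ suc κ) (λ e → (e ℕ.+ suc κ) C e) (λ e → suc (suc κ ℕ.+ p ℕ.+ q) ∸ suc κ ∸ e) d (suc p)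
           (λ e e<len _ d≡ → absent e (e≤p e<len) (trans d≡ (inner₂-exponent κ p q e (e≤p e<len)))))
        (when-no (suc p <? suc (suc κ ℕ.+ p ∸ suc κ)) _ (λ p<len → ℕP.<-irrefl (sym (inner₂-length κ p)) (ℕP.≤-pred p<len)))
  where
  e≤p : ∀ {e} → e < suc (suc κ ℕ.+ p ∸ suc κ) → e ≤ p
  e≤p e<len = subst (_ ≤_) (inner₂-length κ p) (ℕP.≤-pred e<len)

coeff₂-inner₂-present : ∀ κ p q w → w ≤ p →
  coeff₂ (inner₂ (suc κ ℕ.+ p ℕ.+ q) (suc κ ℕ.+ p) (suc κ)) 0 (suc (w ℕ.+ q)) ≡ + ((p ∸ w ℕ.+ suc κ) C (p ∸ w))
coeff₂-inner₂-present κ p q w w≤p = begin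
  coeff₂ (inner₂ (suc κ ℕ.+ p ℕ.+ q) (suc κ ℕ.+ p) (suc κ)) 0 (suc (w ℕ.+ q))
    ≡⟨ coeff₂-Σnat*u^ (suc κ ℕ.+ p ∸ suc κ) (λ e → (e ℕ.+ suc κ) C e) exponent (suc (w ℕ.+ q)) (p ∸ w) unique ⟩
  when (p ∸ w <? suc (suc κ ℕ.+ p ∸ suc κ)) (+ ((p ∸ w ℕ.+ suc κ) C (p ∸ w)) ℤ.* coeff₂ (u^ (exponent (p ∸ w))) 0 (suc (w ℕ.+ q)))
    ≡⟨ when-yes (p ∸ w <? _) _ (s≤s (subst (p ∸ w ≤_) (sym (inner₂-length κ p)) (ℕP.m∸n≤m p w))) ⟩
  + ((p ∸ w ℕ.+ suc κ) C (p ∸ w)) ℤ.* coeff₂ (u^ (exponent (p ∸ w))) 0 (suc (w ℕ.+ q))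
    ≡⟨ cong (+ ((p ∸ w ℕ.+ suc κ) C (p ∸ w)) ℤ.*_) hit ⟩
  + ((p ∸ w ℕ.+ suc κ) C (p ∸ w)) ℤ.* + 1
    ≡⟨ ℤP.*-identityʳ _ ⟩
  + ((p ∸ w ℕ.+ suc κ) C (p ∸ w))
    ∎
  where
  open ≡-Reasoning
  exponent : ℕ → ℕ
  exponent e = suc (suc κ ℕ.+ p ℕ.+ q) ∸ suc κ ∸ e
  unique : ∀ e → e < suc (suc κ ℕ.+ p ∸ suc κ) → ¬ e ≡ p ∸ w → ¬ suc (w ℕ.+ q) ≡ exponent e
  unique e e<len e≢ w+q+1≡ = e≢ (trans (sym (ℕP.m∸[m∸n]≡n e≤p)) (cong (p ∸_) (sym w≡p∸e)))
    where
    e≤p : e ≤ p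
    e≤p = subst (_ ≤_) (inner₂-length κ p) (ℕP.≤-pred e<len)
    w≡p∸e : w ≡ p ∸ e
    w≡p∸e = ℕP.+-cancelʳ-≡ q w (p ∸ e) (ℕP.suc-injective (trans w+q+1≡ (inner₂-exponent κ p q e e≤p)))
  hit : coeff₂ (u^ (exponent (p ∸ w))) 0 (suc (w ℕ.+ q)) ≡ + 1
  hit = subst (λ n → coeff₂ (u^ n) 0 (suc (w ℕ.+ q)) ≡ + 1)
              (sym (trans (inner₂-exponent κ p q (p ∸ w) (ℕP.m∸n≤m p w)) (cong (λ n → suc (n ℕ.+ q)) (ℕP.m∸[m∸n]≡n w≤p))))
              (coeff₂-u^-diag (suc (w ℕ.+ q)))

coeff₂-inner₁-beyond : ∀ m i k d → m ∸ i < d → coeff₂ (inner₁ m i k) 0 d ≡ + 0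
coeff₂-inner₁-beyond m i k d m∸i<d =
  trans (coeff₂-Σnat*u^ (m ∸ i) (λ e → (e ℕ.+ k ∸ 1) C e) (λ e → e) d d (λ e _ e≢d d≡e → e≢d (sym d≡e)))
        (when-no (d <? suc (m ∸ i)) _ (λ d≤m∸i → ℕP.<⇒≱ m∸i<d (ℕP.≤-pred d≤m∸i)))

coeff₂-inner₂-low : ∀ j q κ d → κ < j → d ≤ q → coeff₂ (inner₂ (j ℕ.+ q) j (suc κ)) 0 d ≡ + 0
coeff₂-inner₂-low j q κ d κ<j d≤q with ℕP.m≤n⇒∃[o]m+o≡n κ<j
... | p , refl = coeff₂-inner₂-absent κ p q d
  (λ e _ d≡ → ℕP.n≮n q (ℕP.<-≤-trans (s≤s (ℕP.m≤n+m q (p ∸ e))) (subst (_≤ q) d≡ d≤q)))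

coeff₂-inner₂-high : ∀ j q κ w → κ < j →
  coeff₂ (inner₂ (j ℕ.+ q) j (suc κ)) 0 (suc (w ℕ.+ q)) ≡ + ((j ∸ w) C suc κ)
coeff₂-inner₂-high j q κ w κ<j with ℕP.m≤n⇒∃[o]m+o≡n κ<j
... | p , refl with w ≤? p
...   | yes w≤p = begin
  coeff₂ (inner₂ (suc κ ℕ.+ p ℕ.+ q) (suc κ ℕ.+ p) (suc κ)) 0 (suc (w ℕ.+ q))
    ≡⟨ coeff₂-inner₂-present κ p q w w≤p ⟩
  + ((p ∸ w ℕ.+ suc κ) C (p ∸ w))
    ≡⟨ cong +_ ([m+n]Cm≡[m+n]Cn (p ∸ w) (suc κ)) ⟩
  + ((p ∸ w ℕ.+ suc κ) C suc κ)
    ≡⟨ cong (λ n → + (n C suc κ)) (trans (ℕP.+-comm (p ∸ w) (suc κ)) (sym (ℕP.+-∸-assoc (suc κ) w≤p))) ⟩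
  + ((suc κ ℕ.+ p ∸ w) C suc κ)
    ∎
  where open ≡-Reasoning
...   | no w≰p = trans (coeff₂-inner₂-absent κ p q (suc (w ℕ.+ q))
            (λ e _ w+q+1≡ → ℕP.<⇒≱ p<w (subst (_≤ p) (sym (ℕP.+-cancelʳ-≡ q w (p ∸ e) (ℕP.suc-injective w+q+1≡))) (ℕP.m∸n≤m p e))))
            (cong +_ (sym (k>n⇒nCk≡0 (s≤s small))))
  where
  p<w : p < w
  p<w = ℕP.≰⇒> w≰p
  small : suc κ ℕ.+ p ∸ w ≤ κ
  small = ℕP.≤-trans (ℕP.∸-monoʳ-≤ (suc κ ℕ.+ p) p<w) (ℕP.≤-reflexive (ℕP.m+n∸n≡m κ p))

only-middle : ∀ {a b c x : ℤ} → a ≡ + 0 → b ≡ x → c ≡ + 0 → (a ℤ.+ b) ℤ.+ c ≡ x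
only-middle refl refl refl = trans (ℤP.+-identityʳ _) (ℤP.+-identityˡ _)

only-last : ∀ {a b c x : ℤ} → a ≡ + 0 → b ≡ + 0 → c ≡ x → (a ℤ.+ b) ℤ.+ c ≡ x
only-last refl refl refl = ℤP.+-identityˡ _

coeff₂-Hlow-low : ∀ m j q → j ℕ.+ q ≡ m → ∀ κ d → d ≤ q →
  coeff₂ (Hlow m j) (suc κ) (suc (d ℕ.+ j)) ≡ [-1]^ (suc κ) ℤ.* (+ (suc j C suc κ) ℤ.* + ((d ℕ.+ κ) C κ))
coeff₂-Hlow-low _ j q refl κ d d≤q =
  trans (cong (coeff₂ (Hlow (j ℕ.+ q) j) (suc κ)) (cong suc (ℕP.+-comm d j)))
  (trans (coeff₂-Hlow (j ℕ.+ q) j (suc κ) d)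
        (only-middle (coeff₂-oneP-z κ d) (trans (coeff₂-outer₁ (j ℕ.+ q) j κ d) from-outer₁)
                     (trans (coeff₂-outer₂ (j ℕ.+ q) j κ d) from-outer₂)))
  where
  s : ℤ
  s = [-1]^ (suc κ)
  open ≡-Reasoning
  from-outer₁ : when (κ <? suc j) (s ℤ.* + (suc j C suc κ) ℤ.* coeff₂ (inner₁ (j ℕ.+ q) j (suc κ)) 0 d)
                ≡ s ℤ.* (+ (suc j C suc κ) ℤ.* + ((d ℕ.+ κ) C κ))
  from-outer₁ = begin
    when (κ <? suc j) (s ℤ.* + (suc j C suc κ) ℤ.* coeff₂ (inner₁ (j ℕ.+ q) j (suc κ)) 0 d)
      ≡⟨ when-cong (κ <? suc j) (cong (s ℤ.* + (suc j C suc κ) ℤ.*_)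
           (coeff₂-inner₁ (j ℕ.+ q) j κ d (subst (d ≤_) (sym (ℕP.m+n∸m≡n j q)) d≤q))) ⟩
    when (κ <? suc j) (s ℤ.* + (suc j C suc κ) ℤ.* + ((d ℕ.+ κ) C κ))
      ≡⟨ when-redundant (κ <? suc j) _ (λ κ≮j+1 →
           trans (cong (λ c → s ℤ.* + c ℤ.* + ((d ℕ.+ κ) C κ)) (k>n⇒nCk≡0 (s≤s (ℕP.≮⇒≥ κ≮j+1))))
                 (cong (ℤ._* + ((d ℕ.+ κ) C κ)) (ℤP.*-zeroʳ s))) ⟩
    s ℤ.* + (suc j C suc κ) ℤ.* + ((d ℕ.+ κ) C κ)
      ≡⟨ ℤP.*-assoc s _ _ ⟩
    s ℤ.* (+ (suc j C suc κ) ℤ.* + ((d ℕ.+ κ) C κ))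
      ∎
  from-outer₂ : when (κ <? j) (s ℤ.* + ((j ℕ.+ q ℕ.+ suc κ ∸ j ∸ 1) C κ) ℤ.* coeff₂ (inner₂ (j ℕ.+ q) j (suc κ)) 0 d) ≡ + 0
  from-outer₂ = when-vanishing (κ <? j) (s ℤ.* + ((j ℕ.+ q ℕ.+ suc κ ∸ j ∸ 1) C κ) ℤ.* coeff₂ (inner₂ (j ℕ.+ q) j (suc κ)) 0 d) (λ κ<j →
    trans (cong (s ℤ.* + ((j ℕ.+ q ℕ.+ suc κ ∸ j ∸ 1) C κ) ℤ.*_) (coeff₂-inner₂-low j q κ d κ<j d≤q))
          (ℤP.*-zeroʳ (s ℤ.* + ((j ℕ.+ q ℕ.+ suc κ ∸ j ∸ 1) C κ))))

coeff₂-Hlow-high : ∀ m j q → j ℕ.+ q ≡ m → ∀ κ w →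
  coeff₂ (Hlow m j) (suc κ) (suc (suc (w ℕ.+ m))) ≡ [-1]^ (suc κ) ℤ.* (+ ((q ℕ.+ κ) C κ) ℤ.* + ((j ∸ w) C suc κ))
coeff₂-Hlow-high _ j q refl κ w =
  trans (cong (coeff₂ (Hlow (j ℕ.+ q) j) (suc κ)) (position j q w))
        (trans (coeff₂-Hlow (j ℕ.+ q) j (suc κ) (suc (w ℕ.+ q)))
               (only-last (coeff₂-oneP-z κ (suc (w ℕ.+ q)))
                          (trans (coeff₂-outer₁ (j ℕ.+ q) j κ (suc (w ℕ.+ q))) from-outer₁)
                          (trans (coeff₂-outer₂ (j ℕ.+ q) j κ (suc (w ℕ.+ q))) from-outer₂)))
  where
  s : ℤ
  s = [-1]^ (suc κ)
  position : ∀ j q w → suc (suc (w ℕ.+ (j ℕ.+ q))) ≡ suc j ℕ.+ suc (w ℕ.+ q)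
  position = ℕ-Solver.solve-∀
  from-outer₁ : when (κ <? suc j) (s ℤ.* + (suc j C suc κ) ℤ.* coeff₂ (inner₁ (j ℕ.+ q) j (suc κ)) 0 (suc (w ℕ.+ q))) ≡ + 0
  from-outer₁ = when-vanishing (κ <? suc j) (s ℤ.* + (suc j C suc κ) ℤ.* coeff₂ (inner₁ (j ℕ.+ q) j (suc κ)) 0 (suc (w ℕ.+ q))) (λ _ →
    trans (cong (s ℤ.* + (suc j C suc κ) ℤ.*_)
                (coeff₂-inner₁-beyond (j ℕ.+ q) j (suc κ) (suc (w ℕ.+ q))
                   (s≤s (subst (_≤ w ℕ.+ q) (sym (ℕP.m+n∸m≡n j q)) (ℕP.m≤n+m q w)))))
          (ℤP.*-zeroʳ (s ℤ.* + (suc j C suc κ))))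
  outer₂-index : j ℕ.+ q ℕ.+ suc κ ∸ j ∸ 1 ≡ q ℕ.+ κ
  outer₂-index = begin
    j ℕ.+ q ℕ.+ suc κ ∸ j ∸ 1    ≡⟨ cong (λ n → n ∸ j ∸ 1) (ℕP.+-assoc j q (suc κ)) ⟩
    j ℕ.+ (q ℕ.+ suc κ) ∸ j ∸ 1  ≡⟨ cong (_∸ 1) (ℕP.m+n∸m≡n j (q ℕ.+ suc κ)) ⟩
    q ℕ.+ suc κ ∸ 1              ≡⟨ cong (_∸ 1) (ℕP.+-suc q κ) ⟩
    q ℕ.+ κ                      ∎
    where open ≡-Reasoning
  from-outer₂ : when (κ <? j) (s ℤ.* + ((j ℕ.+ q ℕ.+ suc κ ∸ j ∸ 1) C κ) ℤ.* coeff₂ (inner₂ (j ℕ.+ q) j (suc κ)) 0 (suc (w ℕ.+ q)))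
                ≡ s ℤ.* (+ ((q ℕ.+ κ) C κ) ℤ.* + ((j ∸ w) C suc κ))
  from-outer₂ with κ <? j
  ... | yes κ<j = trans (cong₂ (λ n c → s ℤ.* + (n C κ) ℤ.* c) outer₂-index (coeff₂-inner₂-high j q κ w κ<j))
                        (ℤP.*-assoc s _ _)
  ... | no κ≮j = sym (trans (cong (λ c → s ℤ.* (+ ((q ℕ.+ κ) C κ) ℤ.* + c))
                                  (k>n⇒nCk≡0 (s≤s (ℕP.≤-trans (ℕP.m∸n≤m j w) (ℕP.≮⇒≥ κ≮j)))))
                            (trans (cong (s ℤ.*_) (ℤP.*-zeroʳ (+ ((q ℕ.+ κ) C κ)))) (ℤP.*-zeroʳ s)))

-- Coefficients of H_{m+1}

-- Htop m is definitionally u^{m+2} (1 − z · weights m).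
weights : ℕ → ℤ[z,u]
weights m = Σ[ 0 ⋯ m ] (λ e → u^ e *ₚ nat (suc m ∸ e))

coeff₂-u^*nat-z : ∀ e c a d → coeff₂ (u^ e *ₚ nat c) (suc a) d ≡ + 0
coeff₂-u^*nat-z e c a d with d ℕ.≟ e
... | yes refl = trans (cong (coeff₂ (u^ d *ₚ nat c) (suc a)) (sym (ℕP.+-identityʳ d))) (coeff₂-u^* d (nat c) (suc a) 0)
... | no d≢e = coeff₂-u^*const-off e (Z.const (+ c)) (suc a) d d≢e

coeff₂-weights-z : ∀ m a d → coeff₂ (weights m) (suc a) d ≡ + 0
coeff₂-weights-z m a d = trans (coeff₂-Σ 0 m (λ e → u^ e *ₚ nat (suc m ∸ e)) (suc a) d)
  (sumBelow-zero _ (suc m) (λ e _ → coeff₂-u^*nat-z e (suc m ∸ e) a d))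

coeff₂-weights : ∀ m d → coeff₂ (weights m) 0 d ≡ + (suc m ∸ d)
coeff₂-weights m d = begin
  coeff₂ (weights m) 0 d
    ≡⟨ coeff₂-Σ 0 m (λ e → u^ e *ₚ nat (suc m ∸ e)) 0 d ⟩
  sumBelow (λ e → coeff₂ (u^ e *ₚ nat (suc m ∸ e)) 0 d) (suc m)
    ≡⟨ sumBelow-select _ (suc m) d (λ e _ e≢d → coeff₂-u^*const-off e (Z.const (+ (suc m ∸ e))) 0 d (e≢d ∘ sym)) ⟩
  when (d <? suc m) (coeff₂ (u^ d *ₚ nat (suc m ∸ d)) 0 d)
    ≡⟨ when-cong (d <? suc m) (trans (cong (coeff₂ (u^ d *ₚ nat (suc m ∸ d)) 0) (sym (ℕP.+-identityʳ d)))
                                      (coeff₂-u^* d (nat (suc m ∸ d)) 0 0)) ⟩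
  when (d <? suc m) (+ (suc m ∸ d))
    ≡⟨ when-redundant (d <? suc m) _ (λ d≮m+1 → cong +_ (ℕP.m≤n⇒m∸n≡0 (ℕP.≮⇒≥ d≮m+1))) ⟩
  + (suc m ∸ d)
    ∎
  where open ≡-Reasoning

coeff₂-Htop : ∀ m a e → coeff₂ (Htop m) a (suc (suc m) ℕ.+ e) ≡ coeff₂ oneP a e ℤ.- coeff₂ (zP *ₚ weights m) a e
coeff₂-Htop m a e = trans (coeff₂-u^* (suc (suc m)) (oneP -ₚ zP *ₚ weights m) a e) (coeff₂--ₚ oneP (zP *ₚ weights m) a e)

coeff₂-Htop-below : ∀ m a b → b < suc (suc m) → coeff₂ (Htop m) a b ≡ + 0
coeff₂-Htop-below m = coeff₂-u^*-below (suc (suc m)) (oneP -ₚ zP *ₚ weights m)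

coeff₂-Htop-z⁰-diag : ∀ m → coeff₂ (Htop m) 0 (suc (suc m)) ≡ + 1
coeff₂-Htop-z⁰-diag m = begin
  coeff₂ (Htop m) 0 (suc (suc m))         ≡⟨ cong (coeff₂ (Htop m) 0 ∘ suc ∘ suc) (ℕP.+-identityʳ m) ⟨
  coeff₂ (Htop m) 0 (suc (suc m) ℕ.+ 0)   ≡⟨ coeff₂-Htop m 0 0 ⟩
  + 1 ℤ.- coeff₂ (zP *ₚ weights m) 0 0    ≡⟨ cong (ℤ._-_ (+ 1)) (coeff₂-zP*-0 (weights m) 0) ⟩
  + 1                                     ∎
  where open ≡-Reasoning

coeff₂-Htop-z⁰-off : ∀ m b → ¬ (b ≡ suc (suc m)) → coeff₂ (Htop m) 0 b ≡ + 0
coeff₂-Htop-z⁰-off m b b≢m+2 with b <? suc (suc m)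
... | yes b<m+2 = coeff₂-Htop-below m 0 b b<m+2
... | no b≮m+2 with ℕP.m≤n⇒∃[o]m+o≡n (ℕP.≮⇒≥ b≮m+2)
...   | zero , m+2+0≡b = ⊥-elim (b≢m+2 (trans (sym m+2+0≡b) (ℕP.+-identityʳ _)))
...   | suc e , refl = trans (coeff₂-Htop m 0 (suc e)) (cong (ℤ._-_ (+ 0)) (coeff₂-zP*-0 (weights m) (suc e)))

coeff₂-Htop-z¹ : ∀ m e → coeff₂ (Htop m) 1 (suc (suc (e ℕ.+ m))) ≡ - + (suc m ∸ e)
coeff₂-Htop-z¹ m e = begin
  coeff₂ (Htop m) 1 (suc (suc (e ℕ.+ m)))        ≡⟨ cong (coeff₂ (Htop m) 1 ∘ suc ∘ suc) (ℕP.+-comm e m) ⟩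
  coeff₂ (Htop m) 1 (suc (suc m) ℕ.+ e)          ≡⟨ coeff₂-Htop m 1 e ⟩
  coeff₂ oneP 1 e ℤ.- coeff₂ (zP *ₚ weights m) 1 e ≡⟨ cong₂ ℤ._-_ (coeff₂-oneP-z 0 e) (trans (coeff₂-zP* (weights m) 0 e) (coeff₂-weights m e)) ⟩
  + 0 ℤ.- + (suc m ∸ e)                          ≡⟨ ℤP.+-identityˡ _ ⟩
  - + (suc m ∸ e)                                ∎
  where open ≡-Reasoning

coeff₂-Htop-z²⁺ : ∀ m a b → coeff₂ (Htop m) (suc (suc a)) b ≡ + 0
coeff₂-Htop-z²⁺ m a b with b <? suc (suc m)
... | yes b<m+2 = coeff₂-Htop-below m (suc (suc a)) b b<m+2
... | no b≮m+2 with ℕP.m≤n⇒∃[o]m+o≡n (ℕP.≮⇒≥ b≮m+2)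
...   | e , refl = trans (coeff₂-Htop m (suc (suc a)) e)
          (cong₂ ℤ._-_ (coeff₂-oneP-z (suc a) e) (trans (coeff₂-zP* (weights m) (suc a) e) (coeff₂-weights-z m a e)))

pascal : ∀ n k → + (suc n C suc k) ≡ + (n C k) ℤ.+ + (n C suc k)
pascal n k = trans (cong +_ (sym (nCk+nC[k+1]≡[n+1]C[k+1] n k))) (ℤP.pos-+ (n C k) (n C suc k))

pascal-∸ : ∀ n w k → + ((n ∸ w) C suc (suc k)) ≡ + ((n ∸ suc w) C suc k) ℤ.+ + ((n ∸ suc w) C suc (suc k))
pascal-∸ n w k with w <? n
... | yes w<n rewrite ℕP.+-∸-assoc 1 w<n = pascal (n ∸ suc w) (suc k)
... | no w≮n rewrite ℕP.m≤n⇒m∸n≡0 (ℕP.≮⇒≥ w≮n) | ℕP.m≤n⇒m∸n≡0 (ℕP.m≤n⇒m≤1+n (ℕP.≮⇒≥ w≮n)) = refl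

+nCn≡+1 : ∀ n → + (n C n) ≡ + 1
+nCn≡+1 n = cong +_ (nCn≡1 n)

+nC1≡+n : ∀ n → + (n C 1) ≡ + n
+nC1≡+n n = cong +_ (nC1≡n n)

-- Each gap recurrence is checked by evaluating the five coefficients involved and closing with a ring identity.
gap-up-from : ∀ {Q′ P′ Q P E q′ p′ q p e : ℤ} → Q′ ≡ q′ → P′ ≡ p′ → Q ≡ q → P ≡ p → E ≡ e →
  q′ ℤ.- p′ ≡ (q ℤ.- p) ℤ.- e → Q′ ℤ.- P′ ≡ (Q ℤ.- P) ℤ.- E
gap-up-from refl refl refl refl refl identity = identity

gap-down-from : ∀ {Q P E Q′ P′ q p e q′ p′ : ℤ} → Q ≡ q → P ≡ p → E ≡ e → Q′ ≡ q′ → P′ ≡ p′ →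
  q ℤ.- p ≡ e ℤ.+ (q′ ℤ.- p′) → Q ℤ.- P ≡ E ℤ.+ (Q′ ℤ.- P′)
gap-down-from refl refl refl refl refl identity = identity

gap-zero-from : ∀ {Q P q p : ℤ} → Q ≡ q → P ≡ p → q ℤ.- p ≡ + 0 → Q ℤ.- P ≡ + 0
gap-zero-from refl refl identity = identity

module LowStep (m j r : ℕ) (j+1+r≡m : suc j ℕ.+ r ≡ m) where
  private
    P Q : ℤ[z,u]
    P = Hlow m j
    Q = Hlow m (suc j)

    j+r+1≡m : j ℕ.+ suc r ≡ m
    j+r+1≡m = trans (ℕP.+-suc j r) j+1+r≡m

    P-low : ∀ κ d → d ≤ suc r →
      coeff₂ P (suc κ) (suc (d ℕ.+ j)) ≡ [-1]^ (suc κ) ℤ.* (+ (suc j C suc κ) ℤ.* + ((d ℕ.+ κ) C κ))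
    P-low = coeff₂-Hlow-low m j (suc r) j+r+1≡m

    Q-low : ∀ κ d → d ≤ r →
      coeff₂ Q (suc κ) (suc (d ℕ.+ suc j)) ≡ [-1]^ (suc κ) ℤ.* (+ (suc (suc j) C suc κ) ℤ.* + ((d ℕ.+ κ) C κ))
    Q-low = coeff₂-Hlow-low m (suc j) r j+1+r≡m

    P-high : ∀ κ w →
      coeff₂ P (suc κ) (suc (suc (w ℕ.+ m))) ≡ [-1]^ (suc κ) ℤ.* (+ ((suc r ℕ.+ κ) C κ) ℤ.* + ((j ∸ w) C suc κ))
    P-high = coeff₂-Hlow-high m j (suc r) j+r+1≡m

    Q-high : ∀ κ w →
      coeff₂ Q (suc κ) (suc (suc (w ℕ.+ m))) ≡ [-1]^ (suc κ) ℤ.* (+ ((r ℕ.+ κ) C κ) ℤ.* + ((suc j ∸ w) C suc κ))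
    Q-high = coeff₂-Hlow-high m (suc j) r j+1+r≡m

    Q-at : ∀ κ d → d ≤ r →
      coeff₂ Q (suc κ) (suc (suc (d ℕ.+ j))) ≡ [-1]^ (suc κ) ℤ.* (+ (suc (suc j) C suc κ) ℤ.* + ((d ℕ.+ κ) C κ))
    Q-at κ d d≤r = trans (cong (coeff₂ Q (suc κ) ∘ suc) (sym (ℕP.+-suc d j))) (Q-low κ d d≤r)

    P-z⁰-off : ∀ b → ¬ b ≡ j → coeff₂ P 0 (suc b) ≡ + 0
    P-z⁰-off b b≢j = coeff₂-Hlow-z⁰-off m j (suc b) (b≢j ∘ ℕP.suc-injective)

    GapUp : ℕ → ℕ → Set
    GapUp a b = gap P Q a (suc b) ≡ gap P Q a b ℤ.- coeff₂ P a (suc b)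

    gap-up-below : ∀ a b → b < j → GapUp a b
    gap-up-below a b b<j =
      gap-up-from (coeff₂-Hlow-below m (suc j) (suc a) (suc (suc b)) (s≤s (s≤s b<j)))
                  (coeff₂-Hlow-below m j (suc a) (suc b) (s≤s b<j))
                  (coeff₂-Hlow-below m (suc j) (suc a) (suc b) (s≤s (s≤s (ℕP.<⇒≤ b<j))))
                  (coeff₂-Hlow-below m j (suc a) b (s≤s (ℕP.<⇒≤ b<j)))
                  (P-below a) refl
      where
      P-below : ∀ a → coeff₂ P a (suc b) ≡ + 0
      P-below zero = P-z⁰-off b (ℕP.<⇒≢ b<j)
      P-below (suc a) = coeff₂-Hlow-below m j (suc a) (suc b) (s≤s b<j)

    gap-up-at : ∀ a → GapUp a j
    gap-up-at a =
      gap-up-from (trans (Q-low a 0 z≤n) (cong₂ (λ x y → [-1]^ (suc a) ℤ.* (x ℤ.* y)) (pascal (suc j) a) (+nCn≡+1 a)))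
                  (trans (P-low a 0 z≤n) (cong (λ y → [-1]^ (suc a) ℤ.* (+ (suc j C suc a) ℤ.* y)) (+nCn≡+1 a)))
                  (coeff₂-Hlow-below m (suc j) (suc a) (suc j) ℕP.≤-refl)
                  (coeff₂-Hlow-below m j (suc a) j ℕP.≤-refl)
                  (P-at a)
                  (identity ([-1]^ a) (+ (suc j C a)) (+ (suc j C suc a)))
      where
      P-at : ∀ a → coeff₂ P a (suc j) ≡ [-1]^ a ℤ.* (+ (suc j C a) ℤ.* + 1)
      P-at zero = coeff₂-Hlow-z⁰-diag m j
      P-at (suc a) = trans (P-low a 0 z≤n) (cong (λ y → [-1]^ (suc a) ℤ.* (+ (suc j C suc a) ℤ.* y)) (+nCn≡+1 a))
      identity : ∀ s G H → (- s) ℤ.* ((G ℤ.+ H) ℤ.* + 1) ℤ.- (- s) ℤ.* (H ℤ.* + 1) ≡ (+ 0 ℤ.- + 0) ℤ.- s ℤ.* (G ℤ.* + 1)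
      identity = solve-∀

    gap-up-above : ∀ a d → d < r → GapUp a (suc (d ℕ.+ j))
    gap-up-above zero d d<r =
      gap-up-from (Q-at 0 (suc d) d<r) (P-low 0 (suc d) (s≤s (ℕP.<⇒≤ d<r)))
                  (Q-at 0 d (ℕP.<⇒≤ d<r)) (P-low 0 d (ℕP.m≤n⇒m≤1+n (ℕP.<⇒≤ d<r)))
                  (P-z⁰-off (suc (d ℕ.+ j)) (λ eq → ℕP.m≢1+n+m j (sym eq)))
                  (identity ([-1]^ 1 ℤ.* (+ (suc (suc j) C 1) ℤ.* + ((d ℕ.+ 0) C 0)))
                            ([-1]^ 1 ℤ.* (+ (suc j C 1) ℤ.* + ((d ℕ.+ 0) C 0))))
      where
      identity : ∀ x y → x ℤ.- y ≡ (x ℤ.- y) ℤ.- + 0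
      identity = solve-∀
    gap-up-above (suc a) d d<r =
      gap-up-from (trans (Q-at (suc a) (suc d) d<r)
                         (cong₂ (λ x y → s′ ℤ.* (x ℤ.* y)) (pascal (suc j) (suc a)) (pascal (d ℕ.+ suc a) a)))
                  (trans (P-low (suc a) (suc d) (s≤s (ℕP.<⇒≤ d<r)))
                         (cong (λ y → s′ ℤ.* (+ (suc j C suc (suc a)) ℤ.* y)) (pascal (d ℕ.+ suc a) a)))
                  (trans (Q-at (suc a) d (ℕP.<⇒≤ d<r))
                         (cong (λ x → s′ ℤ.* (x ℤ.* + ((d ℕ.+ suc a) C suc a))) (pascal (suc j) (suc a))))
                  (P-low (suc a) d (ℕP.m≤n⇒m≤1+n (ℕP.<⇒≤ d<r)))
                  (trans (P-low a (suc d) (s≤s (ℕP.<⇒≤ d<r)))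
                         (cong (λ n → [-1]^ (suc a) ℤ.* (+ (suc j C suc a) ℤ.* + (n C a))) (sym (ℕP.+-suc d a))))
                  (identity ([-1]^ (suc a)) (+ (suc j C suc a)) (+ (suc j C suc (suc a)))
                            (+ ((d ℕ.+ suc a) C a)) (+ ((d ℕ.+ suc a) C suc a)))
      where
      s′ : ℤ
      s′ = [-1]^ (suc (suc a))
      identity : ∀ s G H W V → (- s) ℤ.* ((G ℤ.+ H) ℤ.* (W ℤ.+ V)) ℤ.- (- s) ℤ.* (H ℤ.* (W ℤ.+ V))
                   ≡ ((- s) ℤ.* ((G ℤ.+ H) ℤ.* V) ℤ.- (- s) ℤ.* (H ℤ.* V)) ℤ.- s ℤ.* (G ℤ.* W)
      identity = solve-∀

    gap-up : ∀ a b → b < m → GapUp a b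
    gap-up a b b<m with ℕP.<-cmp b j
    ... | tri< b<j _ _ = gap-up-below a b b<j
    ... | tri≈ _ refl _ = gap-up-at a
    ... | tri> _ _ j<b with ℕP.m≤n⇒∃[o]m+o≡n j<b
    ...   | d , refl = subst (GapUp a) (cong suc (ℕP.+-comm d j)) (gap-up-above a d d<r)
      where
      d<r : d < r
      d<r = ℕP.+-cancelˡ-< (suc j) d r (subst (suc (suc j ℕ.+ d) ≤_) (sym j+1+r≡m) b<m)

    GapDown : ℕ → ℕ → Set
    GapDown a w = gap P Q a (suc (w ℕ.+ m))
                    ≡ coeff₂ P a (suc (suc (w ℕ.+ m))) ℤ.+ gap P Q a (suc (suc (w ℕ.+ m)))

    P-z⁰-beyond : ∀ w → coeff₂ P 0 (suc (suc (w ℕ.+ m))) ≡ + 0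
    P-z⁰-beyond w = P-z⁰-off (suc (w ℕ.+ m))
      (λ eq → ℕP.<-irrefl (sym eq) (s≤s (ℕP.≤-trans (subst (j ≤_) j+r+1≡m (ℕP.m≤m+n j (suc r))) (ℕP.m≤n+m m w))))

    gap-down-first : ∀ a → GapDown a 0
    gap-down-first zero =
      gap-down-from (Q-high 0 0) (trans (cong (coeff₂ P 1) at-m+1) (P-low 0 (suc r) ℕP.≤-refl))
                    (P-z⁰-beyond 0) (Q-high 0 1) (P-high 0 0)
                    (identity (+ (suc j C 1)) (+ (j C 1)))
      where
      at-m+1 : suc m ≡ suc (suc r ℕ.+ j)
      at-m+1 = cong suc (trans (sym j+r+1≡m) (ℕP.+-comm j (suc r)))
      identity : ∀ X Y → - + 1 ℤ.* (+ 1 ℤ.* X) ℤ.- - + 1 ℤ.* (X ℤ.* + 1)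
                           ≡ + 0 ℤ.+ (- + 1 ℤ.* (+ 1 ℤ.* Y) ℤ.- - + 1 ℤ.* (+ 1 ℤ.* Y))
      identity = solve-∀
    gap-down-first (suc a) =
      gap-down-from (trans (Q-high (suc a) 0) (cong (λ x → s′ ℤ.* (+ ((r ℕ.+ suc a) C suc a) ℤ.* x)) (pascal j (suc a))))
                    (trans (cong (coeff₂ P (suc (suc a))) at-m+1) (trans (P-low (suc a) (suc r) ℕP.≤-refl)
                       (cong₂ (λ x y → s′ ℤ.* (x ℤ.* y)) (pascal j (suc a)) (pascal (r ℕ.+ suc a) a))))
                    (trans (P-high a 0) (cong (λ n → [-1]^ (suc a) ℤ.* (+ (n C a) ℤ.* + (j C suc a))) (sym (ℕP.+-suc r a))))
                    (Q-high (suc a) 1)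
                    (trans (P-high (suc a) 0) (cong (λ x → s′ ℤ.* (x ℤ.* + (j C suc (suc a)))) (pascal (r ℕ.+ suc a) a)))
                    (identity ([-1]^ (suc a)) (+ ((r ℕ.+ suc a) C a)) (+ ((r ℕ.+ suc a) C suc a)) (+ (j C suc a)) (+ (j C suc (suc a))))
      where
      s′ : ℤ
      s′ = [-1]^ (suc (suc a))
      at-m+1 : suc m ≡ suc (suc r ℕ.+ j)
      at-m+1 = cong suc (trans (sym j+r+1≡m) (ℕP.+-comm j (suc r)))
      identity : ∀ s D E G H → (- s) ℤ.* (E ℤ.* (G ℤ.+ H)) ℤ.- (- s) ℤ.* ((G ℤ.+ H) ℤ.* (D ℤ.+ E))
                   ≡ s ℤ.* (D ℤ.* G) ℤ.+ ((- s) ℤ.* (E ℤ.* H) ℤ.- (- s) ℤ.* ((D ℤ.+ E) ℤ.* H))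
      identity = solve-∀

    gap-down-later : ∀ a w → GapDown a (suc w)
    gap-down-later zero w =
      gap-down-from (Q-high 0 (suc w)) (P-high 0 w) (P-z⁰-beyond (suc w)) (Q-high 0 (suc (suc w))) (P-high 0 (suc w))
                    (identity (+ ((j ∸ w) C 1)) (+ ((j ∸ suc w) C 1)))
      where
      identity : ∀ X Y → - + 1 ℤ.* (+ 1 ℤ.* X) ℤ.- - + 1 ℤ.* (+ 1 ℤ.* X)
                           ≡ + 0 ℤ.+ (- + 1 ℤ.* (+ 1 ℤ.* Y) ℤ.- - + 1 ℤ.* (+ 1 ℤ.* Y))
      identity = solve-∀
    gap-down-later (suc a) w =
      gap-down-from (trans (Q-high (suc a) (suc w)) (cong (λ x → s′ ℤ.* (+ ((r ℕ.+ suc a) C suc a) ℤ.* x)) (pascal-∸ j w a)))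
                    (trans (P-high (suc a) w) (cong₂ (λ x y → s′ ℤ.* (x ℤ.* y)) (pascal (r ℕ.+ suc a) a) (pascal-∸ j w a)))
                    (trans (P-high a (suc w)) (cong (λ n → [-1]^ (suc a) ℤ.* (+ (n C a) ℤ.* + ((j ∸ suc w) C suc a))) (sym (ℕP.+-suc r a))))
                    (Q-high (suc a) (suc (suc w)))
                    (trans (P-high (suc a) (suc w)) (cong (λ x → s′ ℤ.* (x ℤ.* + ((j ∸ suc w) C suc (suc a)))) (pascal (r ℕ.+ suc a) a)))
                    (identity ([-1]^ (suc a)) (+ ((r ℕ.+ suc a) C a)) (+ ((r ℕ.+ suc a) C suc a))
                              (+ ((j ∸ suc w) C suc a)) (+ ((j ∸ suc w) C suc (suc a))))
      where
      s′ : ℤ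
      s′ = [-1]^ (suc (suc a))
      identity : ∀ s D E T₁ T₂ → (- s) ℤ.* (E ℤ.* (T₁ ℤ.+ T₂)) ℤ.- (- s) ℤ.* ((D ℤ.+ E) ℤ.* (T₁ ℤ.+ T₂))
                   ≡ s ℤ.* (D ℤ.* T₁) ℤ.+ ((- s) ℤ.* (E ℤ.* T₂) ℤ.- (- s) ℤ.* ((D ℤ.+ E) ℤ.* T₂))
      identity = solve-∀

    gap-beyond : ∀ a w → suc j ≤ w → gap P Q a (suc (w ℕ.+ m)) ≡ + 0
    gap-beyond a (suc w) (s≤s j≤w) =
      gap-zero-from (trans (Q-high a (suc w)) (cong (λ n → [-1]^ (suc a) ℤ.* (+ ((r ℕ.+ a) C a) ℤ.* + (n C suc a))) j∸w≡0))
                    (trans (P-high a w) (cong (λ n → [-1]^ (suc a) ℤ.* (+ ((suc r ℕ.+ a) C a) ℤ.* + (n C suc a))) j∸w≡0))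
                    (identity ([-1]^ (suc a)) (+ ((r ℕ.+ a) C a)) (+ ((suc r ℕ.+ a) C a)))
      where
      j∸w≡0 : j ∸ w ≡ 0
      j∸w≡0 = ℕP.m≤n⇒m∸n≡0 j≤w
      identity : ∀ s E F → s ℤ.* (E ℤ.* + 0) ℤ.- s ℤ.* (F ℤ.* + 0) ≡ + 0
      identity = solve-∀

  isUZ∇Step : IsUZ∇Step m (Hlow m j) (Hlow m (suc j))
  isUZ∇Step = record
    { z⁰u⁰-zero  = coeff₂-Hlow-z⁰-off m (suc j) 0 (λ ())
    ; z⁰-shift   = z⁰-shift
    ; Q-u⁰-zero  = λ a → coeff₂-Hlow-below m (suc j) (suc a) 0 (s≤s z≤n)
    ; P-u⁰-zero  = λ a → coeff₂-Hlow-below m j a 0 (s≤s z≤n)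
    ; gap-zero   = λ a → gap-zero-from (coeff₂-Hlow-below m (suc j) (suc a) 1 (s≤s (s≤s z≤n)))
                                       (coeff₂-Hlow-below m j (suc a) 0 (s≤s z≤n)) refl
    ; gap-up     = gap-up
    ; gap-down   = λ { a zero → gap-down-first a ; a (suc w) → gap-down-later a w }
    ; gap-bound  = suc j
    ; gap-beyond = gap-beyond
    }
    where
    z⁰-shift : ∀ b → coeff₂ Q 0 (suc b) ≡ coeff₂ P 0 b
    z⁰-shift b with b ℕ.≟ suc j
    ... | yes refl = trans (coeff₂-Hlow-z⁰-diag m (suc j)) (sym (coeff₂-Hlow-z⁰-diag m j))
    ... | no b≢j+1 = trans (coeff₂-Hlow-z⁰-off m (suc j) (suc b) (b≢j+1 ∘ ℕP.suc-injective))
                           (sym (coeff₂-Hlow-z⁰-off m j b b≢j+1))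

module TopStep (m : ℕ) where
  private
    P Q : ℤ[z,u]
    P = Hlow m m
    Q = Htop m

    P-low : ∀ κ → coeff₂ P (suc κ) (suc m) ≡ [-1]^ (suc κ) ℤ.* (+ (suc m C suc κ) ℤ.* + (κ C κ))
    P-low κ = coeff₂-Hlow-low m m 0 (ℕP.+-identityʳ m) κ 0 z≤n

    P-high : ∀ κ w → coeff₂ P (suc κ) (suc (suc (w ℕ.+ m))) ≡ [-1]^ (suc κ) ℤ.* (+ (κ C κ) ℤ.* + ((m ∸ w) C suc κ))
    P-high = coeff₂-Hlow-high m m 0 (ℕP.+-identityʳ m)

    P-z⁰-beyond : ∀ w → coeff₂ P 0 (suc (suc (w ℕ.+ m))) ≡ + 0
    P-z⁰-beyond w = coeff₂-Hlow-z⁰-off m m _ (λ eq → ℕP.m≢1+n+m m (sym (ℕP.suc-injective eq)))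

    gap-up : ∀ a b → b < m → gap P Q a (suc b) ≡ gap P Q a b ℤ.- coeff₂ P a (suc b)
    gap-up a b b<m =
      gap-up-from (coeff₂-Htop-below m (suc a) (suc (suc b)) (s≤s (s≤s b<m)))
                  (coeff₂-Hlow-below m m (suc a) (suc b) (s≤s b<m))
                  (coeff₂-Htop-below m (suc a) (suc b) (s≤s (s≤s (ℕP.<⇒≤ b<m))))
                  (coeff₂-Hlow-below m m (suc a) b (s≤s (ℕP.<⇒≤ b<m)))
                  (P-below a) refl
      where
      P-below : ∀ a → coeff₂ P a (suc b) ≡ + 0
      P-below zero = coeff₂-Hlow-z⁰-off m m (suc b) (ℕP.<⇒≢ b<m ∘ ℕP.suc-injective)
      P-below (suc a) = coeff₂-Hlow-below m m (suc a) (suc b) (s≤s b<m)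

    GapDown : ℕ → ℕ → Set
    GapDown a w = gap P Q a (suc (w ℕ.+ m))
                    ≡ coeff₂ P a (suc (suc (w ℕ.+ m))) ℤ.+ gap P Q a (suc (suc (w ℕ.+ m)))

    gap-down-first : ∀ a → GapDown a 0
    gap-down-first zero =
      gap-down-from (coeff₂-Htop-z¹ m 0)
                    (trans (P-low 0) (cong (λ x → [-1]^ 1 ℤ.* (x ℤ.* + 1)) (+nC1≡+n (suc m))))
                    (P-z⁰-beyond 0)
                    (coeff₂-Htop-z¹ m 1)
                    (trans (P-high 0 0) (cong (λ x → [-1]^ 1 ℤ.* (+ 1 ℤ.* x)) (+nC1≡+n m)))
                    (identity (+ (suc m)) (+ m))
      where
      identity : ∀ X Y → - X ℤ.- (- + 1 ℤ.* (X ℤ.* + 1)) ≡ + 0 ℤ.+ (- Y ℤ.- (- + 1 ℤ.* (+ 1 ℤ.* Y)))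
      identity = solve-∀
    gap-down-first (suc a) =
      gap-down-from (coeff₂-Htop-z²⁺ m a (suc (suc m)))
                    (trans (P-low (suc a)) (cong₂ (λ x y → s′ ℤ.* (x ℤ.* y)) (pascal m (suc a)) (+nCn≡+1 (suc a))))
                    (trans (P-high a 0) (cong (λ x → [-1]^ (suc a) ℤ.* (x ℤ.* + (m C suc a))) (+nCn≡+1 a)))
                    (coeff₂-Htop-z²⁺ m a (suc (suc (suc m))))
                    (trans (P-high (suc a) 0) (cong (λ x → s′ ℤ.* (x ℤ.* + (m C suc (suc a)))) (+nCn≡+1 (suc a))))
                    (identity ([-1]^ (suc a)) (+ (m C suc a)) (+ (m C suc (suc a))))
      where
      s′ : ℤ
      s′ = [-1]^ (suc (suc a))
      identity : ∀ s G H → + 0 ℤ.- (- s) ℤ.* ((G ℤ.+ H) ℤ.* + 1)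
                             ≡ s ℤ.* (+ 1 ℤ.* G) ℤ.+ (+ 0 ℤ.- (- s) ℤ.* (+ 1 ℤ.* H))
      identity = solve-∀

    gap-down-later : ∀ a w → GapDown a (suc w)
    gap-down-later zero w =
      gap-down-from (coeff₂-Htop-z¹ m (suc w))
                    (trans (P-high 0 w) (cong (λ x → [-1]^ 1 ℤ.* (+ 1 ℤ.* x)) (+nC1≡+n (m ∸ w))))
                    (P-z⁰-beyond (suc w))
                    (coeff₂-Htop-z¹ m (suc (suc w)))
                    (trans (P-high 0 (suc w)) (cong (λ x → [-1]^ 1 ℤ.* (+ 1 ℤ.* x)) (+nC1≡+n (m ∸ suc w))))
                    (identity (+ (m ∸ w)) (+ (m ∸ suc w)))
      where
      identity : ∀ X Y → - X ℤ.- (- + 1 ℤ.* (+ 1 ℤ.* X)) ≡ + 0 ℤ.+ (- Y ℤ.- (- + 1 ℤ.* (+ 1 ℤ.* Y)))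
      identity = solve-∀
    gap-down-later (suc a) w =
      gap-down-from (coeff₂-Htop-z²⁺ m a (suc (suc (suc w ℕ.+ m))))
                    (trans (P-high (suc a) w) (cong₂ (λ x y → s′ ℤ.* (x ℤ.* y)) (+nCn≡+1 (suc a)) (pascal-∸ m w a)))
                    (trans (P-high a (suc w)) (cong (λ x → [-1]^ (suc a) ℤ.* (x ℤ.* + ((m ∸ suc w) C suc a))) (+nCn≡+1 a)))
                    (coeff₂-Htop-z²⁺ m a (suc (suc (suc (suc w) ℕ.+ m))))
                    (trans (P-high (suc a) (suc w)) (cong (λ x → s′ ℤ.* (x ℤ.* + ((m ∸ suc w) C suc (suc a)))) (+nCn≡+1 (suc a))))
                    (identity ([-1]^ (suc a)) (+ ((m ∸ suc w) C suc a)) (+ ((m ∸ suc w) C suc (suc a))))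
      where
      s′ : ℤ
      s′ = [-1]^ (suc (suc a))
      identity : ∀ s G H → + 0 ℤ.- (- s) ℤ.* (+ 1 ℤ.* (G ℤ.+ H))
                             ≡ s ℤ.* (+ 1 ℤ.* G) ℤ.+ (+ 0 ℤ.- (- s) ℤ.* (+ 1 ℤ.* H))
      identity = solve-∀

    gap-beyond : ∀ a w → suc m ≤ w → gap P Q a (suc (w ℕ.+ m)) ≡ + 0
    gap-beyond a (suc w) (s≤s m≤w) =
      gap-zero-from (Q-beyond a)
                    (trans (P-high a w) (cong (λ n → [-1]^ (suc a) ℤ.* (+ (a C a) ℤ.* + (n C suc a))) m∸w≡0))
                    (identity ([-1]^ (suc a)) (+ (a C a)))
      where
      m∸w≡0 : m ∸ w ≡ 0
      m∸w≡0 = ℕP.m≤n⇒m∸n≡0 m≤w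
      Q-beyond : ∀ a → coeff₂ Q (suc a) (suc (suc (suc w ℕ.+ m))) ≡ + 0
      Q-beyond zero = trans (coeff₂-Htop-z¹ m (suc w)) (cong (-_ ∘ +_) m∸w≡0)
      Q-beyond (suc a) = coeff₂-Htop-z²⁺ m a _
      identity : ∀ s E → + 0 ℤ.- s ℤ.* (E ℤ.* + 0) ≡ + 0
      identity = solve-∀

  isUZ∇Step : IsUZ∇Step m (Hlow m m) (Htop m)
  isUZ∇Step = record
    { z⁰u⁰-zero  = coeff₂-Htop-z⁰-off m 0 (λ ())
    ; z⁰-shift   = z⁰-shift
    ; Q-u⁰-zero  = λ a → coeff₂-Htop-below m (suc a) 0 (s≤s z≤n)
    ; P-u⁰-zero  = λ a → coeff₂-Hlow-below m m a 0 (s≤s z≤n)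
    ; gap-zero   = λ a → gap-zero-from (coeff₂-Htop-below m (suc a) 1 (s≤s (s≤s z≤n)))
                                       (coeff₂-Hlow-below m m (suc a) 0 (s≤s z≤n)) refl
    ; gap-up     = gap-up
    ; gap-down   = λ { a zero → gap-down-first a ; a (suc w) → gap-down-later a w }
    ; gap-bound  = suc m
    ; gap-beyond = gap-beyond
    }
    where
    z⁰-shift : ∀ b → coeff₂ Q 0 (suc b) ≡ coeff₂ P 0 b
    z⁰-shift b with b ℕ.≟ suc m
    ... | yes refl = trans (coeff₂-Htop-z⁰-diag m) (sym (coeff₂-Hlow-z⁰-diag m m))
    ... | no b≢m+1 = trans (coeff₂-Htop-z⁰-off m (suc b) (b≢m+1 ∘ ℕP.suc-injective))
                           (sym (coeff₂-Hlow-z⁰-off m m b b≢m+1))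

H≡Hlow : ∀ m i → i ≤ m → H m i ≡ Hlow m i
H≡Hlow m i i≤m with i ≤? m
... | yes _ = refl
... | no i≰m = ⊥-elim (i≰m i≤m)

H≡Htop : ∀ m → H m (suc m) ≡ Htop m
H≡Htop m with suc m ≤? m
... | yes m<m = ⊥-elim (ℕP.<-irrefl refl m<m)
... | no _ = refl

propositionA2 : (m : ℕ) → 1 ≤ m → (i : ℕ) → 1 ≤ i → i ≤ suc m →
    H m i ≈ₚ ((uP *ₚ H m (i ∸ 1)) +ₚ (zP *ₚ ∇ m (H m (i ∸ 1))))
propositionA2 m _ (suc j) _ (s≤s j≤m) with ℕP.m≤n⇒m<n∨m≡n j≤m
... | inj₁ j<m with ℕP.m≤n⇒∃[o]m+o≡n j<m
...   | r , j+1+r≡m = subst₂ (UZ∇Step m) (sym (H≡Hlow m j j≤m)) (sym (H≡Hlow m (suc j) j<m))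
                             (IsUZ∇Step⇒≈ (LowStep.isUZ∇Step m j r j+1+r≡m))
propositionA2 m _ (suc m) _ _ | inj₂ refl =
  subst₂ (UZ∇Step m) (sym (H≡Hlow m m ℕP.≤-refl)) (sym (H≡Htop m)) (IsUZ∇Step⇒≈ (TopStep.isUZ∇Step m))
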